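{- Let $A=\mathbb{F}_q[t]$, where $q$ is a power of a prime $p$, and let $a\in A$. Call a monic irreducible $\wp\in A$ of degree $d$ an $a$-Wieferich prime if $a^{q^d}\equiv a\pmod{\wp^2}$. Then: (i) If there are infinitely many $a$-Wieferich primes, then $a=b^p$ for some $b\in A$, and then every monic irreducible polynomial of $A$ is $a$-Wieferich. (ii) There are no $a$-Wieferich primes if and only if $a=b^p+ct$ for some $b\in A$ and $c\in\mathbb{F}_q^*$. -}

module Defs where

open import Data.Nat using (ℕ; zero; suc; _<_) renaming (_^_ to _^ℕ_)
open import Data.Nat.Primality using (Prime)
open import Data.Fin using (Fin)
open import Data.List using (List; []; _∷_; map)
open import Data.List.Relation.Unary.All using (All)
open import Data.Product using (Σ; _×_; _,_)
open import Data.Sum using (_⊎_)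
open import Relation.Nullary using (¬_)
open import Relation.Binary.PropositionalEquality using (_≡_; _≢_)
open import Relation.Binary.Definitions using (DecidableEquality)
open import Algebra.Structures using (IsCommutativeRing)
open import Function.Bundles using (_↔_)

natCast : {F : Set} → (F → F → F) → F → F → ℕ → F
natCast _+_ 0# 1# zero    = 0#
natCast _+_ 0# 1# (suc n) = 1# + natCast _+_ 0# 1# n

-- A finite field F_q with q = p ^ k, p prime, of characteristic p.
-- Equality on the carrier is propositional equality (w.l.o.g.: any finite
-- field can be transported along its bijection with Fin q).
record FiniteField : Set₁ where
  infixl 6 _+_
  infixl 7 _*_
  field
    F    : Set
    _≟_  : DecidableEquality F
    _+_  : F → F → F
    _*_  : F → F → F
    -_   : F → F
    0#   : F
    1#   : F
    isCommutativeRing : IsCommutativeRing _≡_ _+_ _*_ -_ 0# 1#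
    0≢1  : 0# ≢ 1#
    inverse : ∀ x → x ≢ 0# → Σ F (λ y → x * y ≡ 1#)
    p    : ℕ
    p-prime : Prime p
    k    : ℕ
    q    : ℕ
    q≡p^k : q ≡ p ^ℕ k
    enum : F ↔ Fin q

    char-p : natCast _+_ 0# 1# p ≡ 0#

-- The polynomial ring A = F_q[t], polynomials as little-endian coefficient
-- lists, compared coefficientwise (so trailing zeros are irrelevant).
module PolyOver (K : FiniteField) where
  open FiniteField K

  Poly : Set
  Poly = List F

  coeff : Poly → ℕ → F
  coeff []       _       = 0#
  coeff (c ∷ f)  zero    = c
  coeff (c ∷ f)  (suc n) = coeff f n

  infix 4 _≈_
  _≈_ : Poly → Poly → Set
  f ≈ g = ∀ n → coeff f n ≡ coeff g n

  infixl 6 _+ₚ_ _-ₚ_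
  infixl 7 _*ₚ_
  infixr 8 _^ₚ_

  _+ₚ_ : Poly → Poly → Poly
  []      +ₚ g       = g
  (a ∷ f) +ₚ []      = a ∷ f
  (a ∷ f) +ₚ (b ∷ g) = (a + b) ∷ (f +ₚ g)

  negₚ : Poly → Poly
  negₚ = map -_

  _-ₚ_ : Poly → Poly → Poly
  f -ₚ g = f +ₚ negₚ g

  scale : F → Poly → Poly
  scale c = map (c *_)

  _*ₚ_ : Poly → Poly → Poly
  []      *ₚ g = []
  (a ∷ f) *ₚ g = scale a g +ₚ (0# ∷ (f *ₚ g))

  const : F → Poly
  const c = c ∷ []

  1ₚ : Poly
  1ₚ = const 1#

  tₚ : Poly
  tₚ = 0# ∷ 1# ∷ []

  _^ₚ_ : Poly → ℕ → Poly
  f ^ₚ zero  = 1ₚ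
  f ^ₚ suc n = f *ₚ (f ^ₚ n)

  _∣ₚ_ : Poly → Poly → Set
  g ∣ₚ f = Σ Poly (λ h → f ≈ h *ₚ g)

  IsUnit : Poly → Set
  IsUnit f = Σ F (λ c → c ≢ 0# × f ≈ const c)

  Irreducible : Poly → Set
  Irreducible f = ¬ (f ≈ []) × ¬ IsUnit f
                × (∀ g h → f ≈ g *ₚ h → IsUnit g ⊎ IsUnit h)

  MonicOfDegree : Poly → ℕ → Set
  MonicOfDegree f d = coeff f d ≡ 1# × (∀ n → d < n → coeff f n ≡ 0#)

  MonicIrreducible : Poly → ℕ → Set
  MonicIrreducible ℘ d = MonicOfDegree ℘ d × Irreducible ℘

  Wieferich : Poly → Poly → Set
  Wieferich a ℘ = Σ ℕ (λ d → MonicIrreducible ℘ d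
                    × (℘ *ₚ ℘) ∣ₚ ((a ^ₚ (q ^ℕ d)) -ₚ a))

  InfinitelyManyWieferich : Poly → Set
  InfinitelyManyWieferich a =
    ∀ (L : List Poly) → Σ Poly (λ ℘ → Wieferich a ℘ × All (λ g → ¬ (℘ ≈ g)) L)

module Submission where

-- For a monic irreducible ℘ of degree d, Fermat's little theorem in A/℘ (the map x ↦ a·x permutes
-- the q^d residues) gives a^(q^d) − a = u℘.  As q^d = 0 in F, differentiating gives −a′ = u′℘ + u℘′,
-- and ℘ ∤ ℘′ (℘′ = 0 would make ℘ a p-th power), so ℘ is a-Wieferich iff ℘ ∣ a′.  Hence if a′ = 0,
-- i.e. a = b^p, every ℘ is a-Wieferich; if a′ ≠ 0 only the finitely many ℘ of degree ≤ deg a′ can be;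
-- and none is iff a′ is a nonzero constant c, i.e. a − ct = b^p.  A polynomial with a′ = 0 is a p-th
-- power since only exponents divisible by p occur, every element of F is a p-th power and the
-- Frobenius map is additive.

open import Defs
open import Algebra.Bundles using (CommutativeRing; CommutativeMonoid)
import Algebra.Properties.AbelianGroup as AbelianGroupProperties
import Algebra.Properties.CommutativeMonoid.Sum as CommutativeMonoidSum
import Algebra.Properties.CommutativeSemigroup as CommutativeSemigroupProperties
import Algebra.Properties.CommutativeSemiring.Binomial as BinomialProperties
import Algebra.Properties.CommutativeSemiring.Exp as CommutativeSemiringExp
import Algebra.Properties.Group as GroupProperties
import Algebra.Properties.Ring as RingProperties
import Algebra.Properties.Semiring.Exp as SemiringExp
import Algebra.Properties.Semiring.Mult as SemiringMult
import Algebra.Properties.Semiring.Sum as SemiringSum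
import Algebra.Solver.Ring.NaturalCoefficients.Default as NaturalSolver
open import Data.Empty using (⊥; ⊥-elim)
open import Data.Fin as Fin using (Fin; toℕ; combine; remQuot)
import Data.Fin.Properties as FinP
open import Data.Fin.Permutation using (Permutation; permutation)
open import Data.List using (List; []; _∷_; map; allFin; drop; length)
import Data.List.Properties as LP
open import Data.List.Membership.Propositional using (_∈_)
open import Data.List.Membership.Propositional.Properties using (∈-map⁺; ∈-allFin)
open import Data.List.Relation.Unary.All as All using (All)
open import Data.Nat as ℕ using (ℕ; zero; suc; _≤_; _<_; z≤n; s≤s; _∸_; _!; NonZero)
open import Data.Nat.Combinatorics using (_C_; nCk≡n!/k![n-k]!; k![n∸k]!∣n!; nCn≡1; nCk≡nC[n∸k])
open import Data.Nat.Coprimality using (prime⇒coprime; coprime-Bézout)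
open import Data.Nat.Divisibility as ℕ∣ using () renaming (_∣_ to _∣ℕ_)
open import Data.Nat.DivMod using (_%_; _/_; m≡m%n+[m/n]*n; m%n<n; m*[n/m]≡n)
open import Data.Nat.GCD using () renaming (module Bézout to ℕ-Bézout)
open import Data.Nat.Induction using (<-rec)
open import Data.Nat.Primality using (Prime; euclidsLemma; prime⇒nonZero; prime⇒nonTrivial)
import Data.Nat.Properties as ℕP
open import Data.Product using (Σ; _×_; _,_; proj₁; proj₂)
open import Data.Sum using (_⊎_; inj₁; inj₂; [_,_]; [_,_]′)
open import Function using (_∘_; id)
open import Function.Bundles using (Inverse)
open import Relation.Binary.Bundles using (Setoid)
open import Relation.Binary.Definitions using (tri<; tri≈; tri>)
open import Relation.Binary.PropositionalEquality as Eq using (_≡_; _≢_; refl; cong; cong₂)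
import Relation.Binary.Reasoning.Setoid as SetoidReasoning
open import Relation.Nullary using (¬_; Dec; yes; no)
open import Relation.Nullary.Decidable using (_×-dec_)

prime∤! : ∀ {p} → Prime p → ∀ m → m < p → ¬ p ∣ℕ m !
prime∤! p-prime zero    m<p p∣1 = ℕP.<⇒≢ (ℕ.nonTrivial⇒n>1 _ {{prime⇒nonTrivial p-prime}}) (Eq.sym (ℕ∣.∣1⇒≡1 p∣1))
prime∤! p-prime (suc m) m<p p∣m! with euclidsLemma (suc m) (m !) p-prime p∣m!
... | inj₁ p∣1+m = ℕP.<⇒≱ m<p (ℕ∣.∣⇒≤ p∣1+m)
... | inj₂ p∣m!  = prime∤! p-prime m (ℕP.<-trans (ℕP.n<1+n m) m<p) p∣m!

prime∣pCk : ∀ {p k} → Prime p → 0 < k → k < p → p ∣ℕ p C k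
prime∣pCk {p} {k} p-prime 0<k k<p =
  [ (λ p∣k![p-k]! → ⊥-elim ([ prime∤! p-prime k k<p , prime∤! p-prime (p ∸ k) p-k<p ]′
                               (euclidsLemma (k !) ((p ∸ k) !) p-prime p∣k![p-k]!)))
  , id ]′ (euclidsLemma (k ! ℕ.* (p ∸ k) !) (p C k) p-prime p∣k![p-k]!pCk)
  where
  instance _ = prime⇒nonZero p-prime
  instance _ = k ℕP.!* (p ∸ k) !≢0
  p-k<p = ℕP.∸-monoʳ-< {p} {k} {0} 0<k (ℕP.<⇒≤ k<p)
  k![p-k]!pCk≡p! : (k ! ℕ.* (p ∸ k) !) ℕ.* (p C k) ≡ p !
  k![p-k]!pCk≡p! = Eq.trans (cong ((k ! ℕ.* (p ∸ k) !) ℕ.*_) (nCk≡n!/k![n-k]! (ℕP.<⇒≤ k<p)))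
                            (m*[n/m]≡n (k![n∸k]!∣n! (ℕP.<⇒≤ k<p)))
  n∣n! : ∀ n → .{{NonZero n}} → n ∣ℕ n !
  n∣n! (suc n) = ℕ∣.m∣m*n (n !)
  p∣k![p-k]!pCk = Eq.subst (p ∣ℕ_) (Eq.sym k![p-k]!pCk≡p!) (n∣n! p)

injective⇒surjective : ∀ {n} (f : Fin n → Fin n) → (∀ {i j} → f i ≡ f j → i ≡ j) → ∀ j → Σ (Fin n) (λ i → f i ≡ j)
injective⇒surjective {suc n} f f-inj j with FinP.any? (λ i → f i Fin.≟ j)
... | yes hit = hit
... | no miss = ⊥-elim (ℕP.1+n≰n (FinP.injective⇒≤ {f = f′} f′-inj))
  where
  f′ : Fin (suc n) → Fin n
  f′ i = Fin.punchOut {i = j} {j = f i} (λ j≡fi → miss (i , Eq.sym j≡fi))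
  f′-inj : ∀ {a b} → f′ a ≡ f′ b → a ≡ b
  f′-inj {a} {b} e = f-inj (FinP.punchOut-injective {i = j} {j = f a} {k = f b} _ _ e)

module PolynomialsOverFiniteField (K : FiniteField) where
  open FiniteField K
  open PolyOver K

  -- The ring A = F[t]

  F-ring : CommutativeRing _ _
  F-ring = record { isCommutativeRing = isCommutativeRing }
  module FC = CommutativeRing F-ring

  1≢0 : 1# ≢ 0#
  1≢0 e = 0≢1 (Eq.sym e)

  x*y≢0 : ∀ {x y} → x ≢ 0# → y ≢ 0# → x * y ≢ 0#
  x*y≢0 {x} {y} x≢0 y≢0 xy≡0 with inverse x x≢0
  ... | x⁻¹ , xx⁻¹≡1 = y≢0 (begin
    y              ≡⟨ Eq.sym (FC.*-identityˡ y) ⟩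
    1# * y         ≡⟨ cong (_* y) (Eq.trans (Eq.sym xx⁻¹≡1) (FC.*-comm x x⁻¹)) ⟩
    (x⁻¹ * x) * y  ≡⟨ FC.*-assoc x⁻¹ x y ⟩
    x⁻¹ * (x * y)  ≡⟨ cong (x⁻¹ *_) xy≡0 ⟩
    x⁻¹ * 0#       ≡⟨ FC.zeroʳ x⁻¹ ⟩
    0#             ∎)
    where open Eq.≡-Reasoning

  coeff-+ : ∀ f g n → coeff (f +ₚ g) n ≡ coeff f n + coeff g n
  coeff-+ []      g       n       = Eq.sym (FC.+-identityˡ _)
  coeff-+ (a ∷ f) []      n       = Eq.sym (FC.+-identityʳ _)
  coeff-+ (a ∷ f) (b ∷ g) zero    = refl
  coeff-+ (a ∷ f) (b ∷ g) (suc n) = coeff-+ f g n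

  coeff-neg : ∀ f n → coeff (negₚ f) n ≡ - coeff f n
  coeff-neg []      n       = Eq.sym (RingProperties.-0#≈0# FC.ring)
  coeff-neg (a ∷ f) zero    = refl
  coeff-neg (a ∷ f) (suc n) = coeff-neg f n

  coeff-scale : ∀ c f n → coeff (scale c f) n ≡ c * coeff f n
  coeff-scale c []      n       = Eq.sym (FC.zeroʳ c)
  coeff-scale c (a ∷ f) zero    = refl
  coeff-scale c (a ∷ f) (suc n) = coeff-scale c f n

  -- A record around _≈_, so that both sides can be inferred from a proof.
  infix 4 _≃_
  record _≃_ (f g : Poly) : Set where
    constructor ⟨_⟩
    field at : f ≈ g
  open _≃_ public

  ≃-refl : ∀ {f} → f ≃ f
  ≃-refl = ⟨ (λ _ → refl) ⟩

  ≃-reflexive : ∀ {f g} → f ≡ g → f ≃ g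
  ≃-reflexive refl = ≃-refl

  ≃-sym : ∀ {f g} → f ≃ g → g ≃ f
  ≃-sym ⟨ e ⟩ = ⟨ (λ n → Eq.sym (e n)) ⟩

  ≃-trans : ∀ {f g h} → f ≃ g → g ≃ h → f ≃ h
  ≃-trans ⟨ e ⟩ ⟨ e′ ⟩ = ⟨ (λ n → Eq.trans (e n) (e′ n)) ⟩

  ≃-setoid : Setoid _ _
  ≃-setoid = record { Carrier = Poly ; _≈_ = _≃_
                    ; isEquivalence = record { refl = ≃-refl ; sym = ≃-sym ; trans = ≃-trans } }

  module ≃-Reasoning = SetoidReasoning ≃-setoid

  ∷-cong : ∀ {a b f g} → a ≡ b → f ≃ g → (a ∷ f) ≃ (b ∷ g)
  ∷-cong {a} {b} {f} {g} a≡b ⟨ f≈g ⟩ = ⟨ go ⟩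
    where
    go : (a ∷ f) ≈ (b ∷ g)
    go zero    = a≡b
    go (suc n) = f≈g n

  ∷-tail : ∀ {a b f g} → (a ∷ f) ≃ (b ∷ g) → f ≃ g
  ∷-tail ⟨ e ⟩ = ⟨ (λ n → e (suc n)) ⟩

  +ₚ-cong : ∀ {f f′ g g′} → f ≃ f′ → g ≃ g′ → f +ₚ g ≃ f′ +ₚ g′
  +ₚ-cong {f} {f′} {g} {g′} ⟨ e ⟩ ⟨ e′ ⟩ = ⟨ (λ n → begin
    coeff (f +ₚ g) n          ≡⟨ coeff-+ f g n ⟩
    coeff f n + coeff g n     ≡⟨ cong₂ _+_ (e n) (e′ n) ⟩
    coeff f′ n + coeff g′ n   ≡⟨ Eq.sym (coeff-+ f′ g′ n) ⟩
    coeff (f′ +ₚ g′) n        ∎) ⟩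
    where open Eq.≡-Reasoning

  negₚ-cong : ∀ {f g} → f ≃ g → negₚ f ≃ negₚ g
  negₚ-cong {f} {g} ⟨ e ⟩ = ⟨ (λ n →
    Eq.trans (coeff-neg f n) (Eq.trans (cong -_ (e n)) (Eq.sym (coeff-neg g n)))) ⟩

  scale-cong : ∀ {a b f g} → a ≡ b → f ≃ g → scale a f ≃ scale b g
  scale-cong {a} {b} {f} {g} refl ⟨ e ⟩ = ⟨ (λ n →
    Eq.trans (coeff-scale a f n) (Eq.trans (cong (a *_) (e n)) (Eq.sym (coeff-scale a g n)))) ⟩

  +ₚ-assoc : ∀ f g h → (f +ₚ g) +ₚ h ≃ f +ₚ (g +ₚ h)
  +ₚ-assoc f g h = ⟨ (λ n → begin
    coeff ((f +ₚ g) +ₚ h) n                ≡⟨ coeff-+ (f +ₚ g) h n ⟩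
    coeff (f +ₚ g) n + coeff h n           ≡⟨ cong (_+ coeff h n) (coeff-+ f g n) ⟩
    (coeff f n + coeff g n) + coeff h n    ≡⟨ FC.+-assoc _ _ _ ⟩
    coeff f n + (coeff g n + coeff h n)    ≡⟨ cong (coeff f n +_) (Eq.sym (coeff-+ g h n)) ⟩
    coeff f n + coeff (g +ₚ h) n           ≡⟨ Eq.sym (coeff-+ f (g +ₚ h) n) ⟩
    coeff (f +ₚ (g +ₚ h)) n                ∎) ⟩
    where open Eq.≡-Reasoning

  +ₚ-comm : ∀ f g → f +ₚ g ≃ g +ₚ f
  +ₚ-comm f g = ⟨ (λ n →
    Eq.trans (coeff-+ f g n) (Eq.trans (FC.+-comm _ _) (Eq.sym (coeff-+ g f n)))) ⟩

  +ₚ-identityʳ : ∀ f → f +ₚ [] ≃ f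
  +ₚ-identityʳ []      = ≃-refl
  +ₚ-identityʳ (a ∷ f) = ≃-refl

  +ₚ-inverseʳ : ∀ f → f -ₚ f ≃ []
  +ₚ-inverseʳ f = ⟨ (λ n → Eq.trans (coeff-+ f (negₚ f) n)
    (Eq.trans (cong (coeff f n +_) (coeff-neg f n)) (FC.-‿inverseʳ _))) ⟩

  +ₚ-inverseˡ : ∀ f → negₚ f +ₚ f ≃ []
  +ₚ-inverseˡ f = ≃-trans (+ₚ-comm (negₚ f) f) (+ₚ-inverseʳ f)

  +ₚ-interchange : ∀ f g h k → (f +ₚ g) +ₚ (h +ₚ k) ≃ (f +ₚ h) +ₚ (g +ₚ k)
  +ₚ-interchange f g h k = ⟨ (λ n → begin
    coeff ((f +ₚ g) +ₚ (h +ₚ k)) n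
      ≡⟨ Eq.trans (coeff-+ (f +ₚ g) (h +ₚ k) n) (cong₂ _+_ (coeff-+ f g n) (coeff-+ h k n)) ⟩
    (coeff f n + coeff g n) + (coeff h n + coeff k n)
      ≡⟨ CommutativeSemigroupProperties.interchange FC.+-commutativeSemigroup _ _ _ _ ⟩
    (coeff f n + coeff h n) + (coeff g n + coeff k n)
      ≡⟨ Eq.sym (Eq.trans (coeff-+ (f +ₚ h) (g +ₚ k) n) (cong₂ _+_ (coeff-+ f h n) (coeff-+ g k n))) ⟩
    coeff ((f +ₚ h) +ₚ (g +ₚ k)) n ∎) ⟩
    where open Eq.≡-Reasoning

  shift : Poly → Poly
  shift f = 0# ∷ f

  shift-≃[] : ∀ {f} → f ≃ [] → shift f ≃ []
  shift-≃[] {f} ⟨ e ⟩ = ⟨ go ⟩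
    where
    go : shift f ≈ []
    go zero    = refl
    go (suc n) = e n

  coeff-*-∷ : ∀ a f g n → coeff ((a ∷ f) *ₚ g) n ≡ a * coeff g n + coeff (shift (f *ₚ g)) n
  coeff-*-∷ a f g n = Eq.trans (coeff-+ (scale a g) (shift (f *ₚ g)) n)
                               (cong (_+ coeff (shift (f *ₚ g)) n) (coeff-scale a g n))

  *ₚ-zeroˡ : ∀ {f} g → f ≃ [] → f *ₚ g ≃ []
  *ₚ-zeroˡ {[]}    g f≃[]     = ≃-refl
  *ₚ-zeroˡ {a ∷ f} g ⟨ e ⟩ = ⟨ (λ n → begin
    coeff ((a ∷ f) *ₚ g) n                   ≡⟨ coeff-*-∷ a f g n ⟩
    a * coeff g n + coeff (shift (f *ₚ g)) n
      ≡⟨ cong₂ (λ x y → x * coeff g n + y) (e zero) (at (shift-≃[] (*ₚ-zeroˡ {f} g ⟨ (λ m → e (suc m)) ⟩)) n) ⟩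
    0# * coeff g n + 0#                      ≡⟨ Eq.trans (FC.+-identityʳ _) (FC.zeroˡ _) ⟩
    0#                                       ∎) ⟩
    where open Eq.≡-Reasoning

  *ₚ-congˡ : ∀ {f f′} g → f ≃ f′ → f *ₚ g ≃ f′ *ₚ g
  *ₚ-congˡ {[]}    {f′}     g e = ≃-sym (*ₚ-zeroˡ g (≃-sym e))
  *ₚ-congˡ {a ∷ f} {[]}     g e = *ₚ-zeroˡ g e
  *ₚ-congˡ {a ∷ f} {b ∷ f′} g ⟨ e ⟩ = ⟨ (λ n → begin
    coeff ((a ∷ f) *ₚ g) n                    ≡⟨ coeff-*-∷ a f g n ⟩
    a * coeff g n + coeff (shift (f *ₚ g)) n
      ≡⟨ cong₂ (λ x y → x * coeff g n + y) (e zero) (at (∷-cong refl (*ₚ-congˡ g (∷-tail ⟨ e ⟩))) n) ⟩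
    b * coeff g n + coeff (shift (f′ *ₚ g)) n ≡⟨ Eq.sym (coeff-*-∷ b f′ g n) ⟩
    coeff ((b ∷ f′) *ₚ g) n                   ∎) ⟩
    where open Eq.≡-Reasoning

  *ₚ-congʳ : ∀ f {g g′} → g ≃ g′ → f *ₚ g ≃ f *ₚ g′
  *ₚ-congʳ []      e = ≃-refl
  *ₚ-congʳ (a ∷ f) e = +ₚ-cong (scale-cong refl e) (∷-cong refl (*ₚ-congʳ f e))

  *ₚ-cong : ∀ {f f′ g g′} → f ≃ f′ → g ≃ g′ → f *ₚ g ≃ f′ *ₚ g′
  *ₚ-cong {f} {f′} {g} e e′ = ≃-trans (*ₚ-congˡ g e) (*ₚ-congʳ f′ e′)

  ∷≃const+shift : ∀ a f → (a ∷ f) ≃ const a +ₚ shift f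
  ∷≃const+shift a f = ⟨ go ⟩
    where
    go : (a ∷ f) ≈ const a +ₚ shift f
    go zero    = Eq.sym (FC.+-identityʳ a)
    go (suc n) = refl

  shift-+ : ∀ f g → shift (f +ₚ g) ≃ shift f +ₚ shift g
  shift-+ f g = ∷-cong (Eq.sym (FC.+-identityˡ 0#)) ≃-refl

  scale-distribʳ : ∀ c f g → scale c (f +ₚ g) ≃ scale c f +ₚ scale c g
  scale-distribʳ c f g = ⟨ (λ n → begin
    coeff (scale c (f +ₚ g)) n                  ≡⟨ Eq.trans (coeff-scale c (f +ₚ g) n) (cong (c *_) (coeff-+ f g n)) ⟩
    c * (coeff f n + coeff g n)                 ≡⟨ FC.distribˡ c _ _ ⟩
    c * coeff f n + c * coeff g n               ≡⟨ Eq.sym (cong₂ _+_ (coeff-scale c f n) (coeff-scale c g n)) ⟩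
    coeff (scale c f) n + coeff (scale c g) n   ≡⟨ Eq.sym (coeff-+ (scale c f) (scale c g) n) ⟩
    coeff (scale c f +ₚ scale c g) n            ∎) ⟩
    where open Eq.≡-Reasoning

  scale-distribˡ : ∀ a b f → scale (a + b) f ≃ scale a f +ₚ scale b f
  scale-distribˡ a b f = ⟨ (λ n → begin
    coeff (scale (a + b) f) n                   ≡⟨ coeff-scale (a + b) f n ⟩
    (a + b) * coeff f n                         ≡⟨ FC.distribʳ _ a b ⟩
    a * coeff f n + b * coeff f n               ≡⟨ Eq.sym (cong₂ _+_ (coeff-scale a f n) (coeff-scale b f n)) ⟩
    coeff (scale a f) n + coeff (scale b f) n   ≡⟨ Eq.sym (coeff-+ (scale a f) (scale b f) n) ⟩
    coeff (scale a f +ₚ scale b f) n            ∎) ⟩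
    where open Eq.≡-Reasoning

  scale-scale : ∀ a b f → scale a (scale b f) ≃ scale (a * b) f
  scale-scale a b f = ⟨ (λ n → begin
    coeff (scale a (scale b f)) n   ≡⟨ Eq.trans (coeff-scale a (scale b f) n) (cong (a *_) (coeff-scale b f n)) ⟩
    a * (b * coeff f n)             ≡⟨ Eq.sym (FC.*-assoc a b _) ⟩
    (a * b) * coeff f n             ≡⟨ Eq.sym (coeff-scale (a * b) f n) ⟩
    coeff (scale (a * b) f) n       ∎) ⟩
    where open Eq.≡-Reasoning

  scale-zero : ∀ f → scale 0# f ≃ []
  scale-zero f = ⟨ (λ n → Eq.trans (coeff-scale 0# f n) (FC.zeroˡ _)) ⟩

  scale-one : ∀ f → scale 1# f ≃ f
  scale-one f = ⟨ (λ n → Eq.trans (coeff-scale 1# f n) (FC.*-identityˡ _)) ⟩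

  *ₚ-distribʳ : ∀ h f g → (f +ₚ g) *ₚ h ≃ f *ₚ h +ₚ g *ₚ h
  *ₚ-distribʳ h []      g       = ≃-refl
  *ₚ-distribʳ h (a ∷ f) []      = ≃-sym (+ₚ-identityʳ _)
  *ₚ-distribʳ h (a ∷ f) (b ∷ g) =
    ≃-trans (+ₚ-cong (scale-distribˡ a b h) (≃-trans (∷-cong refl (*ₚ-distribʳ h f g)) (shift-+ (f *ₚ h) (g *ₚ h))))
            (+ₚ-interchange (scale a h) (scale b h) (shift (f *ₚ h)) (shift (g *ₚ h)))

  *ₚ-distribˡ : ∀ f g h → f *ₚ (g +ₚ h) ≃ f *ₚ g +ₚ f *ₚ h
  *ₚ-distribˡ []      g h = ≃-refl
  *ₚ-distribˡ (a ∷ f) g h =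
    ≃-trans (+ₚ-cong (scale-distribʳ a g h) (≃-trans (∷-cong refl (*ₚ-distribˡ f g h)) (shift-+ (f *ₚ g) (f *ₚ h))))
            (+ₚ-interchange (scale a g) (scale a h) (shift (f *ₚ g)) (shift (f *ₚ h)))

  *ₚ-zeroʳ : ∀ f → f *ₚ [] ≃ []
  *ₚ-zeroʳ []      = ≃-refl
  *ₚ-zeroʳ (a ∷ f) = shift-≃[] (*ₚ-zeroʳ f)

  scale-*ₚ : ∀ a g h → scale a g *ₚ h ≃ scale a (g *ₚ h)
  scale-*ₚ a []      h = ≃-refl
  scale-*ₚ a (b ∷ g) h =
    ≃-trans (+ₚ-cong (≃-sym (scale-scale a b h)) (∷-cong (Eq.sym (FC.zeroʳ a)) (scale-*ₚ a g h)))
            (≃-sym (scale-distribʳ a (scale b h) (shift (g *ₚ h))))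

  shift-*ₚ : ∀ f g → shift f *ₚ g ≃ shift (f *ₚ g)
  shift-*ₚ f g = +ₚ-cong (scale-zero g) ≃-refl

  *ₚ-assoc : ∀ f g h → (f *ₚ g) *ₚ h ≃ f *ₚ (g *ₚ h)
  *ₚ-assoc []      g h = ≃-refl
  *ₚ-assoc (a ∷ f) g h =
    ≃-trans (*ₚ-distribʳ h (scale a g) (shift (f *ₚ g)))
            (+ₚ-cong (scale-*ₚ a g h) (≃-trans (shift-*ₚ (f *ₚ g) h) (∷-cong refl (*ₚ-assoc f g h))))

  *ₚ-∷ : ∀ f b g → f *ₚ (b ∷ g) ≃ scale b f +ₚ shift (f *ₚ g)
  *ₚ-∷ []      b g = ≃-sym (shift-≃[] ≃-refl)
  *ₚ-∷ (a ∷ f) b g = ∷-cong {f = scale a g +ₚ f *ₚ (b ∷ g)} (cong (_+ 0#) (FC.*-comm a b)) (begin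
    scale a g +ₚ f *ₚ (b ∷ g)                   ≈⟨ +ₚ-cong (≃-refl {scale a g}) (*ₚ-∷ f b g) ⟩
    scale a g +ₚ (scale b f +ₚ shift (f *ₚ g))  ≈⟨ ≃-sym (+ₚ-assoc (scale a g) (scale b f) _) ⟩
    (scale a g +ₚ scale b f) +ₚ shift (f *ₚ g)  ≈⟨ +ₚ-cong (+ₚ-comm (scale a g) (scale b f)) ≃-refl ⟩
    (scale b f +ₚ scale a g) +ₚ shift (f *ₚ g)  ≈⟨ +ₚ-assoc (scale b f) (scale a g) _ ⟩
    scale b f +ₚ (scale a g +ₚ shift (f *ₚ g))  ∎)
    where open ≃-Reasoning

  *ₚ-comm : ∀ f g → f *ₚ g ≃ g *ₚ f
  *ₚ-comm []      g = ≃-sym (*ₚ-zeroʳ g)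
  *ₚ-comm (a ∷ f) g = ≃-trans (+ₚ-cong ≃-refl (∷-cong refl (*ₚ-comm f g))) (≃-sym (*ₚ-∷ g a f))

  *ₚ-identityˡ : ∀ f → 1ₚ *ₚ f ≃ f
  *ₚ-identityˡ f = ≃-trans (+ₚ-cong (scale-one f) (shift-≃[] ≃-refl)) (+ₚ-identityʳ f)

  *ₚ-identityʳ : ∀ f → f *ₚ 1ₚ ≃ f
  *ₚ-identityʳ f = ≃-trans (*ₚ-comm f 1ₚ) (*ₚ-identityˡ f)

  Poly-ring : CommutativeRing _ _
  Poly-ring = record
    { Carrier = Poly ; _≈_ = _≃_ ; _+_ = _+ₚ_ ; _*_ = _*ₚ_ ; -_ = negₚ ; 0# = [] ; 1# = 1ₚ
    ; isCommutativeRing = record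
      { isRing = record
        { +-isAbelianGroup = record
          { isGroup = record
            { isMonoid = record
              { isSemigroup = record
                { isMagma = record
                  { isEquivalence = Setoid.isEquivalence ≃-setoid
                  ; ∙-cong = +ₚ-cong }
                ; assoc = +ₚ-assoc }
              ; identity = (λ _ → ≃-refl) , +ₚ-identityʳ }
            ; inverse = +ₚ-inverseˡ , +ₚ-inverseʳ
            ; ⁻¹-cong = negₚ-cong }
          ; comm = +ₚ-comm }
        ; *-cong = *ₚ-cong
        ; *-assoc = *ₚ-assoc
        ; *-identity = *ₚ-identityˡ , *ₚ-identityʳ
        ; distrib = *ₚ-distribˡ , *ₚ-distribʳ }
      ; *-comm = *ₚ-comm } }

  module NS = NaturalSolver (CommutativeRing.commutativeSemiring Poly-ring)

  module +ₚ-Properties = AbelianGroupProperties (CommutativeRing.+-abelianGroup Poly-ring)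
  module Poly-ringProperties = RingProperties (CommutativeRing.ring Poly-ring)

  [x-y]+[y+z]≃x+z : ∀ x y z → (x -ₚ y) +ₚ (y +ₚ z) ≃ x +ₚ z
  [x-y]+[y+z]≃x+z x y z = begin
    (x -ₚ y) +ₚ (y +ₚ z)          ≈⟨ NS.solve 4 (λ x y n z → (x :+ n) :+ (y :+ z) := x :+ ((y :+ n) :+ z)) ≃-refl x y (negₚ y) z ⟩
    x +ₚ ((y -ₚ y) +ₚ z)          ≈⟨ +ₚ-cong (≃-refl {x}) (+ₚ-cong (+ₚ-inverseʳ y) ≃-refl) ⟩
    x +ₚ z                        ∎
    where
    open ≃-Reasoning
    open NS using (_:+_; _:=_)

  x-[y-z]≃x-y+z : ∀ x y z → x -ₚ (y -ₚ z) ≃ (x -ₚ y) +ₚ z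
  x-[y-z]≃x-y+z x y z = ≃-trans (+ₚ-cong (≃-refl {x}) (+ₚ-Properties.⁻¹-anti-homo‿- y z))
    (NS.solve 3 (λ x z n → x :+ (z :+ n) := (x :+ n) :+ z) ≃-refl x z (negₚ y))
    where open NS using (_:+_; _:=_)

  x-[x-y]≃y : ∀ x y → x -ₚ (x -ₚ y) ≃ y
  x-[x-y]≃y x y = ≃-trans (x-[y-z]≃x-y+z x x y) (+ₚ-cong (+ₚ-inverseʳ x) (≃-refl {y}))

  x-y+y≃x : ∀ x y → (x -ₚ y) +ₚ y ≃ x
  x-y+y≃x x y = ≃-trans (NS.solve 3 (λ x y n → (x :+ n) :+ y := x :+ (y :+ n)) ≃-refl x y (negₚ y))
                  (≃-trans (+ₚ-cong (≃-refl {x}) (+ₚ-inverseʳ y)) (+ₚ-identityʳ x))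
    where open NS using (_:+_; _:=_)

  *ₚ-distribˡ-ₚ : ∀ f g h → f *ₚ (g -ₚ h) ≃ f *ₚ g -ₚ f *ₚ h
  *ₚ-distribˡ-ₚ f g h = ≃-trans (*ₚ-distribˡ f g (negₚ h))
    (+ₚ-cong (≃-refl {f *ₚ g}) (≃-sym (Poly-ringProperties.-‿distribʳ-* f h)))

  *ₚ-distribʳ-ₚ : ∀ h f g → (f -ₚ g) *ₚ h ≃ f *ₚ h -ₚ g *ₚ h
  *ₚ-distribʳ-ₚ h f g = ≃-trans (*ₚ-distribʳ h f (negₚ g))
    (+ₚ-cong (≃-refl {f *ₚ h}) (≃-sym (Poly-ringProperties.-‿distribˡ-* g h)))

  const-*ₚ : ∀ c d → const c *ₚ const d ≃ const (c * d)
  const-*ₚ c d = ∷-cong (FC.+-identityʳ _) ≃-refl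

  scale≃const-*ₚ : ∀ c f → scale c f ≃ const c *ₚ f
  scale≃const-*ₚ c f = ≃-sym (≃-trans (+ₚ-cong (≃-refl {scale c f}) (shift-≃[] ≃-refl)) (+ₚ-identityʳ (scale c f)))

  scale-inverse : ∀ {c c⁻¹} → c * c⁻¹ ≡ 1# → ∀ f → scale c (scale c⁻¹ f) ≃ f
  scale-inverse cc⁻¹≡1 f = ≃-trans (scale-scale _ _ f) (≃-trans (scale-cong cc⁻¹≡1 ≃-refl) (scale-one f))

  -- The formal derivative

  cast : ℕ → F
  cast = natCast _+_ 0# 1#

  cast-+ : ∀ m n → cast (m ℕ.+ n) ≡ cast m + cast n
  cast-+ zero    n = Eq.sym (FC.+-identityˡ _)
  cast-+ (suc m) n = Eq.trans (cong (1# +_) (cast-+ m n)) (Eq.sym (FC.+-assoc _ _ _))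

  cast-* : ∀ m n → cast (m ℕ.* n) ≡ cast m * cast n
  cast-* zero    n = Eq.sym (FC.zeroˡ _)
  cast-* (suc m) n = Eq.trans (cast-+ n (m ℕ.* n)) (Eq.trans (cong (cast n +_) (cast-* m n))
    (Eq.sym (Eq.trans (FC.distribʳ _ _ _) (cong (_+ cast m * cast n) (FC.*-identityˡ _)))))

  cast-*p : ∀ m → cast (m ℕ.* p) ≡ 0#
  cast-*p m = Eq.trans (cast-* m p) (Eq.trans (cong (cast m *_) char-p) (FC.zeroʳ _))

  ∂-from : ℕ → Poly → Poly
  ∂-from m []      = []
  ∂-from m (a ∷ f) = cast m * a ∷ ∂-from (suc m) f

  ∂ : Poly → Poly
  ∂ []      = []
  ∂ (a ∷ f) = ∂-from 1 f

  coeff-∂-from : ∀ m f n → coeff (∂-from m f) n ≡ cast (m ℕ.+ n) * coeff f n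
  coeff-∂-from m []      n       = Eq.sym (FC.zeroʳ _)
  coeff-∂-from m (a ∷ f) zero    = cong (λ k → cast k * a) (Eq.sym (ℕP.+-identityʳ m))
  coeff-∂-from m (a ∷ f) (suc n) = Eq.trans (coeff-∂-from (suc m) f n)
                                            (cong (λ k → cast k * coeff f n) (Eq.sym (ℕP.+-suc m n)))

  coeff-∂ : ∀ f n → coeff (∂ f) n ≡ cast (suc n) * coeff f (suc n)
  coeff-∂ []      n = Eq.sym (FC.zeroʳ _)
  coeff-∂ (a ∷ f) n = coeff-∂-from 1 f n

  ∂-cong : ∀ {f g} → f ≃ g → ∂ f ≃ ∂ g
  ∂-cong {f} {g} ⟨ e ⟩ = ⟨ (λ n → Eq.trans (coeff-∂ f n)
    (Eq.trans (cong (cast (suc n) *_) (e (suc n))) (Eq.sym (coeff-∂ g n)))) ⟩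

  ∂-+ : ∀ f g → ∂ (f +ₚ g) ≃ ∂ f +ₚ ∂ g
  ∂-+ f g = ⟨ (λ n → begin
    coeff (∂ (f +ₚ g)) n                               ≡⟨ coeff-∂ (f +ₚ g) n ⟩
    cast (suc n) * coeff (f +ₚ g) (suc n)              ≡⟨ cong (cast (suc n) *_) (coeff-+ f g (suc n)) ⟩
    cast (suc n) * (coeff f (suc n) + coeff g (suc n)) ≡⟨ FC.distribˡ _ _ _ ⟩
    cast (suc n) * coeff f (suc n) + cast (suc n) * coeff g (suc n)
      ≡⟨ Eq.sym (cong₂ _+_ (coeff-∂ f n) (coeff-∂ g n)) ⟩
    coeff (∂ f) n + coeff (∂ g) n                      ≡⟨ Eq.sym (coeff-+ (∂ f) (∂ g) n) ⟩
    coeff (∂ f +ₚ ∂ g) n                               ∎) ⟩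
    where open Eq.≡-Reasoning

  ∂-scale : ∀ c f → ∂ (scale c f) ≃ scale c (∂ f)
  ∂-scale c f = ⟨ (λ n → begin
    coeff (∂ (scale c f)) n                      ≡⟨ coeff-∂ (scale c f) n ⟩
    cast (suc n) * coeff (scale c f) (suc n)     ≡⟨ cong (cast (suc n) *_) (coeff-scale c f (suc n)) ⟩
    cast (suc n) * (c * coeff f (suc n))         ≡⟨ CommutativeSemigroupProperties.x∙yz≈y∙xz FC.*-commutativeSemigroup _ _ _ ⟩
    c * (cast (suc n) * coeff f (suc n))         ≡⟨ cong (c *_) (Eq.sym (coeff-∂ f n)) ⟩
    c * coeff (∂ f) n                            ≡⟨ Eq.sym (coeff-scale c (∂ f) n) ⟩
    coeff (scale c (∂ f)) n                      ∎) ⟩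
    where open Eq.≡-Reasoning

  ∂-neg : ∀ f → ∂ (negₚ f) ≃ negₚ (∂ f)
  ∂-neg f = ⟨ (λ n → begin
    coeff (∂ (negₚ f)) n                      ≡⟨ coeff-∂ (negₚ f) n ⟩
    cast (suc n) * coeff (negₚ f) (suc n)     ≡⟨ cong (cast (suc n) *_) (coeff-neg f (suc n)) ⟩
    cast (suc n) * - coeff f (suc n)          ≡⟨ Eq.sym (RingProperties.-‿distribʳ-* FC.ring _ _) ⟩
    - (cast (suc n) * coeff f (suc n))        ≡⟨ cong -_ (Eq.sym (coeff-∂ f n)) ⟩
    - coeff (∂ f) n                           ≡⟨ Eq.sym (coeff-neg (∂ f) n) ⟩
    coeff (negₚ (∂ f)) n                      ∎) ⟩
    where open Eq.≡-Reasoning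

  ∂-shift : ∀ f → ∂ (shift f) ≃ f +ₚ shift (∂ f)
  ∂-shift f = ⟨ go ⟩
    where
    open Eq.≡-Reasoning
    go : ∂ (shift f) ≈ f +ₚ shift (∂ f)
    go zero = begin
      coeff (∂ (shift f)) zero  ≡⟨ coeff-∂ (shift f) zero ⟩
      (1# + 0#) * coeff f 0   ≡⟨ cong (_* coeff f 0) (FC.+-identityʳ 1#) ⟩
      1# * coeff f 0          ≡⟨ FC.*-identityˡ _ ⟩
      coeff f 0               ≡⟨ Eq.sym (FC.+-identityʳ _) ⟩
      coeff f 0 + 0#          ≡⟨ Eq.sym (coeff-+ f (shift (∂ f)) zero) ⟩
      coeff (f +ₚ shift (∂ f)) zero ∎
    go (suc n) = begin
      coeff (∂ (shift f)) (suc n)                               ≡⟨ coeff-∂ (shift f) (suc n) ⟩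
      (1# + cast (suc n)) * coeff f (suc n)                     ≡⟨ FC.distribʳ _ _ _ ⟩
      1# * coeff f (suc n) + cast (suc n) * coeff f (suc n)
        ≡⟨ cong₂ _+_ (FC.*-identityˡ _) (Eq.sym (coeff-∂ f n)) ⟩
      coeff f (suc n) + coeff (∂ f) n                           ≡⟨ Eq.sym (coeff-+ f (shift (∂ f)) (suc n)) ⟩
      coeff (f +ₚ shift (∂ f)) (suc n)                          ∎

  ∂-∷ : ∀ a f → ∂ (a ∷ f) ≃ f +ₚ shift (∂ f)
  ∂-∷ a f = ≃-trans (∂-cong (∷≃const+shift a f)) (≃-trans (∂-+ (const a) (shift f)) (∂-shift f))

  ∂-*ₚ : ∀ f g → ∂ (f *ₚ g) ≃ ∂ f *ₚ g +ₚ f *ₚ ∂ g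
  ∂-*ₚ []      g = ≃-refl
  ∂-*ₚ (a ∷ f) g = begin
    ∂ (scale a g +ₚ shift (f *ₚ g))                      ≈⟨ ∂-+ (scale a g) (shift (f *ₚ g)) ⟩
    ∂ (scale a g) +ₚ ∂ (shift (f *ₚ g))                  ≈⟨ +ₚ-cong (∂-scale a g) (∂-shift (f *ₚ g)) ⟩
    scale a (∂ g) +ₚ (f *ₚ g +ₚ shift (∂ (f *ₚ g)))
      ≈⟨ +ₚ-cong (≃-refl {scale a (∂ g)}) (+ₚ-cong (≃-refl {f *ₚ g})
           (≃-trans (∷-cong refl (∂-*ₚ f g)) (shift-+ (∂ f *ₚ g) (f *ₚ ∂ g)))) ⟩
    sag +ₚ (fg +ₚ (shift (∂ f *ₚ g) +ₚ shift (f *ₚ ∂ g)))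
      ≈⟨ NS.solve 4 (λ A B C E → A :+ (B :+ (C :+ E)) := (B :+ C) :+ (A :+ E)) ≃-refl
           sag fg (shift (∂ f *ₚ g)) (shift (f *ₚ ∂ g)) ⟩
    (fg +ₚ shift (∂ f *ₚ g)) +ₚ (a ∷ f) *ₚ ∂ g
      ≈⟨ +ₚ-cong (≃-trans (+ₚ-cong (≃-refl {fg}) (≃-sym (shift-*ₚ (∂ f) g))) (≃-sym (*ₚ-distribʳ g f (shift (∂ f)))))
                 (≃-refl {(a ∷ f) *ₚ ∂ g}) ⟩
    (f +ₚ shift (∂ f)) *ₚ g +ₚ (a ∷ f) *ₚ ∂ g            ≈⟨ +ₚ-cong (*ₚ-congˡ g (≃-sym (∂-∷ a f))) ≃-refl ⟩
    ∂ (a ∷ f) *ₚ g +ₚ (a ∷ f) *ₚ ∂ g                     ∎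
    where
    open ≃-Reasoning
    open NS using (_:+_; _:=_)
    sag = scale a (∂ g)
    fg  = f *ₚ g

  ∂-^ : ∀ f n → ∂ (f ^ₚ suc n) ≃ scale (cast (suc n)) (f ^ₚ n *ₚ ∂ f)
  ∂-^ f zero = begin
    ∂ (f *ₚ 1ₚ)                   ≈⟨ ∂-*ₚ f 1ₚ ⟩
    ∂ f *ₚ 1ₚ +ₚ f *ₚ []          ≈⟨ +ₚ-cong (*ₚ-identityʳ (∂ f)) (*ₚ-zeroʳ f) ⟩
    ∂ f +ₚ []                     ≈⟨ +ₚ-identityʳ (∂ f) ⟩
    ∂ f                           ≈⟨ ≃-sym (≃-trans (scale-one _) (*ₚ-identityˡ (∂ f))) ⟩
    scale 1# (1ₚ *ₚ ∂ f)          ≈⟨ scale-cong (Eq.sym (FC.+-identityʳ 1#)) ≃-refl ⟩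
    scale (1# + 0#) (1ₚ *ₚ ∂ f)   ∎
    where open ≃-Reasoning
  ∂-^ f (suc n) = begin
    ∂ (f *ₚ f ^ₚ suc n)                                     ≈⟨ ∂-*ₚ f (f ^ₚ suc n) ⟩
    ∂ f *ₚ f ^ₚ suc n +ₚ f *ₚ ∂ (f ^ₚ suc n)                ≈⟨ +ₚ-cong ≃-refl (*ₚ-congʳ f (∂-^ f n)) ⟩
    ∂ f *ₚ f ^ₚ suc n +ₚ f *ₚ scale (cast (suc n)) (f ^ₚ n *ₚ ∂ f)
      ≈⟨ +ₚ-cong (≃-trans (*ₚ-comm (∂ f) (f ^ₚ suc n)) (≃-sym (scale-one _)))
                 (≃-trans (*ₚ-comm f _) (≃-trans (scale-*ₚ (cast (suc n)) (f ^ₚ n *ₚ ∂ f) f)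
                   (scale-cong refl (≃-trans (*ₚ-comm _ f) (≃-sym (*ₚ-assoc f (f ^ₚ n) (∂ f))))))) ⟩
    scale 1# (f ^ₚ suc n *ₚ ∂ f) +ₚ scale (cast (suc n)) (f ^ₚ suc n *ₚ ∂ f)
      ≈⟨ ≃-sym (scale-distribˡ 1# (cast (suc n)) _) ⟩
    scale (cast (suc (suc n))) (f ^ₚ suc n *ₚ ∂ f)           ∎
    where open ≃-Reasoning

  -- Degrees

  VanishesAbove : Poly → ℕ → Set
  VanishesAbove f i = ∀ n → i < n → coeff f n ≡ 0#

  DegreeBelow : Poly → ℕ → Set
  DegreeBelow f e = ∀ n → e ≤ n → coeff f n ≡ 0#

  record LeadingTerm (f : Poly) (i : ℕ) (c : F) : Set where
    field
      leading       : coeff f i ≡ c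
      leading≢0     : c ≢ 0#
      vanishesAbove : VanishesAbove f i
  open LeadingTerm public

  HasDegree : Poly → ℕ → Set
  HasDegree f i = Σ F (LeadingTerm f i)

  ≃[]⊎degree : ∀ f → f ≃ [] ⊎ Σ ℕ (HasDegree f)
  ≃[]⊎degree [] = inj₁ ≃-refl
  ≃[]⊎degree (a ∷ f) with ≃[]⊎degree f
  ... | inj₂ (i , c , lt) = inj₂ (suc i , c , record
          { leading = leading lt ; leading≢0 = leading≢0 lt
          ; vanishesAbove = λ { (suc n) (s≤s i<n) → vanishesAbove lt n i<n } })
  ... | inj₁ f≃[] with a ≟ 0#
  ...   | yes a≡0 = inj₁ (≃-trans (∷-cong a≡0 f≃[]) (shift-≃[] ≃-refl))
  ...   | no a≢0  = inj₂ (0 , a , record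
          { leading = refl ; leading≢0 = a≢0 ; vanishesAbove = λ { (suc n) _ → at f≃[] n } })

  LeadingTerm-cong : ∀ {f g i c} → f ≃ g → LeadingTerm f i c → LeadingTerm g i c
  LeadingTerm-cong ⟨ e ⟩ lt = record
    { leading = Eq.trans (Eq.sym (e _)) (leading lt) ; leading≢0 = leading≢0 lt
    ; vanishesAbove = λ n i<n → Eq.trans (Eq.sym (e n)) (vanishesAbove lt n i<n) }

  degree-unique : ∀ {f i j c c′} → LeadingTerm f i c → LeadingTerm f j c′ → i ≡ j
  degree-unique {i = i} {j} lt lt′ with ℕP.<-cmp i j
  ... | tri< i<j _ _ = ⊥-elim (leading≢0 lt′ (Eq.trans (Eq.sym (leading lt′)) (vanishesAbove lt j i<j)))
  ... | tri≈ _ i≡j _ = i≡j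
  ... | tri> _ _ j<i = ⊥-elim (leading≢0 lt (Eq.trans (Eq.sym (leading lt)) (vanishesAbove lt′ i j<i)))

  LeadingTerm⇒≄[] : ∀ {f i c} → LeadingTerm f i c → ¬ (f ≃ [])
  LeadingTerm⇒≄[] lt ⟨ f≈[] ⟩ = leading≢0 lt (Eq.trans (Eq.sym (leading lt)) (f≈[] _))

  LeadingTerm⇒DegreeBelow : ∀ {f i c e} → LeadingTerm f i c → i < e → DegreeBelow f e
  LeadingTerm⇒DegreeBelow lt i<e n e≤n = vanishesAbove lt n (ℕP.<-≤-trans i<e e≤n)

  DegreeBelow⇒degree< : ∀ {f i c e} → LeadingTerm f i c → DegreeBelow f e → i < e
  DegreeBelow⇒degree< {i = i} {e = e} lt below with ℕP.<-≤-connex i e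
  ... | inj₁ i<e = i<e
  ... | inj₂ e≤i = ⊥-elim (leading≢0 lt (Eq.trans (Eq.sym (leading lt)) (below i e≤i)))

  LeadingTerm-const : ∀ {c} → c ≢ 0# → LeadingTerm (const c) 0 c
  LeadingTerm-const c≢0 = record { leading = refl ; leading≢0 = c≢0 ; vanishesAbove = λ { (suc n) _ → refl } }

  LeadingTerm-0⇒≃const : ∀ {f c} → LeadingTerm f 0 c → f ≃ const c
  LeadingTerm-0⇒≃const {f} {c} lt = ⟨ go ⟩
    where
    go : f ≈ const c
    go zero    = leading lt
    go (suc n) = vanishesAbove lt (suc n) (s≤s z≤n)

  monic⇒LeadingTerm : ∀ {f e} → MonicOfDegree f e → LeadingTerm f e 1#
  monic⇒LeadingTerm (lead , above) = record { leading = lead ; leading≢0 = 1≢0 ; vanishesAbove = above }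

  -ₚ-degreeBelow : ∀ f g {e} → DegreeBelow f e → DegreeBelow g e → DegreeBelow (f -ₚ g) e
  -ₚ-degreeBelow f g f<e g<e n e≤n = Eq.trans (coeff-+ f (negₚ g) n)
    (Eq.trans (cong₂ _+_ (f<e n e≤n) (Eq.trans (coeff-neg g n) (cong -_ (g<e n e≤n)))) (FC.-‿inverseʳ 0#))

  scale-inverse-monic : ∀ {f i c c⁻¹} → LeadingTerm f i c → c * c⁻¹ ≡ 1# → MonicOfDegree (scale c⁻¹ f) i
  scale-inverse-monic {f} {i} {c} {c⁻¹} lt cc⁻¹≡1 =
      Eq.trans (coeff-scale c⁻¹ f i) (Eq.trans (cong (c⁻¹ *_) (leading lt)) (Eq.trans (FC.*-comm c⁻¹ c) cc⁻¹≡1))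
    , λ n i<n → Eq.trans (coeff-scale c⁻¹ f n) (Eq.trans (cong (c⁻¹ *_) (vanishesAbove lt n i<n)) (FC.zeroʳ c⁻¹))

  *ₚ-vanishesAbove : ∀ f g {i j} → VanishesAbove f i → VanishesAbove g j → VanishesAbove (f *ₚ g) (i ℕ.+ j)
  *ₚ-vanishesAbove []      g fᵢ gⱼ n _ = refl
  *ₚ-vanishesAbove (a ∷ f) g {i} {j} fᵢ gⱼ n i+j<n = Eq.trans (coeff-*-∷ a f g n)
    (Eq.trans (cong₂ _+_ (Eq.trans (cong (a *_) (gⱼ n (ℕP.≤-<-trans (ℕP.m≤n+m j i) i+j<n))) (FC.zeroʳ a)) (shifted i n i+j<n fᵢ))
              (FC.+-identityˡ 0#))
    where
    shifted : ∀ i n → i ℕ.+ j < n → VanishesAbove (a ∷ f) i → coeff (shift (f *ₚ g)) n ≡ 0#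
    shifted zero    (suc n) _            fᵢ = at (*ₚ-zeroˡ {f} g ⟨ (λ m → fᵢ (suc m) (s≤s z≤n)) ⟩) n
    shifted (suc i) (suc n) (s≤s i+j<n)  fᵢ = *ₚ-vanishesAbove f g (λ m i<m → fᵢ (suc m) (s≤s i<m)) gⱼ n i+j<n

  coeff-*ₚ-top : ∀ f g {i j} → VanishesAbove f i → VanishesAbove g j →
                 coeff (f *ₚ g) (i ℕ.+ j) ≡ coeff f i * coeff g j
  coeff-*ₚ-top []      g {i} fᵢ gⱼ = Eq.sym (FC.zeroˡ _)
  coeff-*ₚ-top (a ∷ f) g {zero} {j} fᵢ gⱼ = begin
    coeff ((a ∷ f) *ₚ g) j                  ≡⟨ coeff-*-∷ a f g j ⟩
    a * coeff g j + coeff (shift (f *ₚ g)) j ≡⟨ cong (a * coeff g j +_) (shifted j) ⟩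
    a * coeff g j + 0#                       ≡⟨ FC.+-identityʳ _ ⟩
    a * coeff g j                            ∎
    where
    open Eq.≡-Reasoning
    shifted : ∀ n → coeff (shift (f *ₚ g)) n ≡ 0#
    shifted zero    = refl
    shifted (suc n) = at (*ₚ-zeroˡ {f} g ⟨ (λ m → fᵢ (suc m) (s≤s z≤n)) ⟩) n
  coeff-*ₚ-top (a ∷ f) g {suc i} {j} fᵢ gⱼ = begin
    coeff ((a ∷ f) *ₚ g) (suc (i ℕ.+ j))     ≡⟨ coeff-*-∷ a f g (suc (i ℕ.+ j)) ⟩
    a * coeff g (suc (i ℕ.+ j)) + coeff (f *ₚ g) (i ℕ.+ j)
      ≡⟨ cong₂ _+_ (Eq.trans (cong (a *_) (gⱼ _ (s≤s (ℕP.m≤n+m j i)))) (FC.zeroʳ a))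
                   (coeff-*ₚ-top f g (λ m i<m → fᵢ (suc m) (s≤s i<m)) gⱼ) ⟩
    0# + coeff f i * coeff g j               ≡⟨ FC.+-identityˡ _ ⟩
    coeff f i * coeff g j                    ∎
    where open Eq.≡-Reasoning

  LeadingTerm-*ₚ : ∀ {f g i j c d} → LeadingTerm f i c → LeadingTerm g j d →
                   LeadingTerm (f *ₚ g) (i ℕ.+ j) (c * d)
  LeadingTerm-*ₚ {f} {g} lf lg = record
    { leading = Eq.trans (coeff-*ₚ-top f g (vanishesAbove lf) (vanishesAbove lg)) (cong₂ _*_ (leading lf) (leading lg))
    ; leading≢0 = x*y≢0 (leading≢0 lf) (leading≢0 lg)
    ; vanishesAbove = *ₚ-vanishesAbove f g (vanishesAbove lf) (vanishesAbove lg) }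

  -- Divisibility, division by monic polynomials, Bézout

  infix 4 _∣_
  _∣_ : Poly → Poly → Set
  g ∣ f = Σ Poly (λ h → f ≃ h *ₚ g)

  ∣-respʳ : ∀ {g f f′} → f ≃ f′ → g ∣ f → g ∣ f′
  ∣-respʳ f≃f′ (h , f≃hg) = h , ≃-trans (≃-sym f≃f′) f≃hg

  ∣-refl : ∀ {g} → g ∣ g
  ∣-refl {g} = 1ₚ , ≃-sym (*ₚ-identityˡ g)

  ∣[] : ∀ {g} → g ∣ []
  ∣[] = [] , ≃-refl

  ∣-trans : ∀ {f g h} → f ∣ g → g ∣ h → f ∣ h
  ∣-trans {f} (k , g≃kf) (l , h≃lg) = l *ₚ k , ≃-trans h≃lg (≃-trans (*ₚ-congʳ l g≃kf) (≃-sym (*ₚ-assoc l k f)))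

  ∣-+ₚ : ∀ {g f f′} → g ∣ f → g ∣ f′ → g ∣ f +ₚ f′
  ∣-+ₚ {g} (h , f≃hg) (k , f′≃kg) = h +ₚ k , ≃-trans (+ₚ-cong f≃hg f′≃kg) (≃-sym (*ₚ-distribʳ g h k))

  ∣-negₚ : ∀ {g f} → g ∣ f → g ∣ negₚ f
  ∣-negₚ {g} (h , f≃hg) = negₚ h , ≃-trans (negₚ-cong f≃hg) (Poly-ringProperties.-‿distribˡ-* h g)

  ∣--ₚ : ∀ {g f f′} → g ∣ f → g ∣ f′ → g ∣ f -ₚ f′
  ∣--ₚ g∣f g∣f′ = ∣-+ₚ g∣f (∣-negₚ g∣f′)

  ∣⇒∣*ˡ : ∀ {g f} k → g ∣ f → g ∣ k *ₚ f
  ∣⇒∣*ˡ {g} k (h , f≃hg) = k *ₚ h , ≃-trans (*ₚ-congʳ k f≃hg) (≃-sym (*ₚ-assoc k h g))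

  ∣⇒∣*ʳ : ∀ {g f} k → g ∣ f → g ∣ f *ₚ k
  ∣⇒∣*ʳ {f = f} k g∣f = ∣-respʳ (*ₚ-comm k f) (∣⇒∣*ˡ k g∣f)

  ∣*ˡ : ∀ {g} k → g ∣ k *ₚ g
  ∣*ˡ k = k , ≃-refl

  ∣∧degree<⇒≃[] : ∀ {r m e c} → m ∣ r → LeadingTerm m e c → DegreeBelow r e → r ≃ []
  ∣∧degree<⇒≃[] {r} {m} {e} (h , r≃hm) lm below with ≃[]⊎degree h
  ... | inj₁ h≃[] = ≃-trans r≃hm (*ₚ-zeroˡ m h≃[])
  ... | inj₂ (i , _ , lh) = ⊥-elim (leading≢0 lhm
         (Eq.trans (Eq.sym (leading lhm)) (Eq.trans (Eq.sym (at r≃hm _)) (below _ (ℕP.m≤n+m e i)))))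
    where lhm = LeadingTerm-*ₚ lh lm

  -- Horner-style: rem (a ∷ f) is t · rem f + a with its tᵉ-coefficient cancelled against m.
  module Division (m : Poly) {e : ℕ} (monic : MonicOfDegree m e) where

    rem : Poly → Poly
    rem []      = []
    rem (a ∷ f) = (a ∷ rem f) -ₚ scale (coeff (a ∷ rem f) e) m

    coeff-rem-∷ : ∀ a f n → coeff (rem (a ∷ f)) n ≡ coeff (a ∷ rem f) n + - (coeff (a ∷ rem f) e * coeff m n)
    coeff-rem-∷ a f n = Eq.trans (coeff-+ (a ∷ rem f) (negₚ (scale (coeff (a ∷ rem f) e) m)) n)
      (cong (coeff (a ∷ rem f) n +_) (Eq.trans (coeff-neg (scale _ m) n) (cong -_ (coeff-scale _ m n))))

    rem-degreeBelow : ∀ f → DegreeBelow (rem f) e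
    rem-degreeBelow []      n e≤n = refl
    rem-degreeBelow (a ∷ f) n e≤n with ℕP.m≤n⇒m<n∨m≡n e≤n
    ... | inj₂ refl = Eq.trans (coeff-rem-∷ a f e)
          (Eq.trans (cong (λ x → c + - (c * x)) (proj₁ monic))
          (Eq.trans (cong (λ x → c + - x) (FC.*-identityʳ c)) (FC.-‿inverseʳ c)))
      where c = coeff (a ∷ rem f) e
    ... | inj₁ e<n@(s≤s e≤n′) = Eq.trans (coeff-rem-∷ a f n)
          (Eq.trans (cong₂ (λ x y → x + - (_ * y)) (rem-degreeBelow f _ e≤n′) (proj₂ monic n e<n))
          (Eq.trans (cong (λ x → 0# + - x) (FC.zeroʳ _)) (FC.-‿inverseʳ 0#)))

    m∣f-rem : ∀ f → m ∣ f -ₚ rem f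
    m∣f-rem []      = ∣[]
    m∣f-rem (a ∷ f) with m∣f-rem f
    ... | h , f-r≃hm = c ∷ h , (begin
      (a ∷ f) -ₚ ((a ∷ r) -ₚ scale c m)  ≈⟨ x-[y-z]≃x-y+z (a ∷ f) (a ∷ r) (scale c m) ⟩
      ((a ∷ f) -ₚ (a ∷ r)) +ₚ scale c m  ≈⟨ +ₚ-cong (∷-cong (FC.-‿inverseʳ a) f-r≃hm) (≃-refl {scale c m}) ⟩
      shift (h *ₚ m) +ₚ scale c m        ≈⟨ +ₚ-comm (shift (h *ₚ m)) (scale c m) ⟩
      scale c m +ₚ shift (h *ₚ m)        ∎)
      where
      open ≃-Reasoning
      r = rem f
      c = coeff (a ∷ r) e

    rem-≃[]⇒∣ : ∀ {f} → rem f ≃ [] → m ∣ f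
    rem-≃[]⇒∣ {f} rem≃[] = ∣-respʳ (≃-trans (+ₚ-cong (≃-refl {f}) (negₚ-cong rem≃[])) (+ₚ-identityʳ f)) (m∣f-rem f)

    ∣⇒rem≃[] : ∀ {f} → m ∣ f → rem f ≃ []
    ∣⇒rem≃[] {f} m∣f = ∣∧degree<⇒≃[] m∣rem (monic⇒LeadingTerm monic) (rem-degreeBelow f)
      where m∣rem = ∣-respʳ (x-[x-y]≃y f (rem f)) (∣--ₚ m∣f (m∣f-rem f))

    m∣? : ∀ f → Dec (m ∣ f)
    m∣? f with ≃[]⊎degree (rem f)
    ... | inj₁ rem≃[]        = yes (rem-≃[]⇒∣ rem≃[])
    ... | inj₂ (_ , _ , lt)  = no (λ m∣f → LeadingTerm⇒≄[] lt (∣⇒rem≃[] m∣f))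

  remainder-combination : ∀ u v m f h r → f -ₚ r ≃ h *ₚ m → u *ₚ r +ₚ v *ₚ m ≃ (v -ₚ u *ₚ h) *ₚ m +ₚ u *ₚ f
  remainder-combination u v m f h r f-r≃hm = begin
    u *ₚ r +ₚ v *ₚ m                       ≈⟨ +ₚ-cong (*ₚ-congʳ u r≃f-hm) ≃-refl ⟩
    u *ₚ (f -ₚ h *ₚ m) +ₚ v *ₚ m           ≈⟨ +ₚ-cong (*ₚ-distribˡ-ₚ u f (h *ₚ m)) ≃-refl ⟩
    (u *ₚ f -ₚ u *ₚ (h *ₚ m)) +ₚ v *ₚ m
      ≈⟨ NS.solve 3 (λ A N C → (A :+ N) :+ C := (C :+ N) :+ A) ≃-refl (u *ₚ f) (negₚ (u *ₚ (h *ₚ m))) (v *ₚ m) ⟩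
    (v *ₚ m -ₚ u *ₚ (h *ₚ m)) +ₚ u *ₚ f
      ≈⟨ +ₚ-cong (≃-trans (+ₚ-cong (≃-refl {v *ₚ m}) (negₚ-cong (≃-sym (*ₚ-assoc u h m))))
                          (≃-sym (*ₚ-distribʳ-ₚ m v (u *ₚ h)))) ≃-refl ⟩
    (v -ₚ u *ₚ h) *ₚ m +ₚ u *ₚ f           ∎
    where
    open ≃-Reasoning
    open NS using (_:+_; _:=_)
    r≃f-hm : r ≃ f -ₚ h *ₚ m
    r≃f-hm = ≃-trans (≃-sym (x-[x-y]≃y f r)) (+ₚ-cong (≃-refl {f}) (negₚ-cong f-r≃hm))

  record Bézout (m f : Poly) : Set where
    field
      gcd u v : Poly
      gcd≃um+vf : gcd ≃ u *ₚ m +ₚ v *ₚ f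
      gcd∣m : gcd ∣ m
      gcd∣f : gcd ∣ f

  monicBézout : ∀ {e} m → MonicOfDegree m e → ∀ f → Bézout m f
  monicBézout {e} = <-rec (λ e → ∀ m → MonicOfDegree m e → ∀ f → Bézout m f) euclid e
    where
    euclid : ∀ e → (∀ {e′} → e′ < e → ∀ m → MonicOfDegree m e′ → ∀ f → Bézout m f) →
             ∀ m → MonicOfDegree m e → ∀ f → Bézout m f
    euclid e recurse m monic f with ≃[]⊎degree (Division.rem m monic f)
    ... | inj₁ rem≃[] = record
      { gcd = m ; u = 1ₚ ; v = []
      ; gcd≃um+vf = ≃-sym (≃-trans (+ₚ-identityʳ (1ₚ *ₚ m)) (*ₚ-identityˡ m))
      ; gcd∣m = ∣-refl ; gcd∣f = Division.rem-≃[]⇒∣ m monic rem≃[] }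
    ... | inj₂ (e′ , c , lr) = record
      { gcd = gcd ; u = v′ -ₚ v *ₚ h ; v = v
      ; gcd≃um+vf = gcd≃um+vf
      ; gcd∣m = gcd∣m
      ; gcd∣f = ∣-respʳ (x-y+y≃x f r) (∣-+ₚ (∣-respʳ (≃-sym f-r≃hm) (∣⇒∣*ˡ h gcd∣m)) gcd∣r) }
      where
      open Division m monic
      r = rem f
      c⁻¹ = proj₁ (inverse c (leading≢0 lr))
      m′ = scale c⁻¹ r
      cc⁻¹≡1 = proj₂ (inverse c (leading≢0 lr))
      monic′ : MonicOfDegree m′ e′
      monic′ = scale-inverse-monic lr cc⁻¹≡1
      open Bézout (recurse (DegreeBelow⇒degree< lr (rem-degreeBelow f)) m′ monic′ m)
        renaming (u to u′; v to v′; gcd≃um+vf to gcd≃u′m′+v′m; gcd∣m to gcd∣m′; gcd∣f to gcd∣m)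
      h = proj₁ (m∣f-rem f)
      f-r≃hm = proj₂ (m∣f-rem f)
      v = u′ *ₚ const c⁻¹
      gcd∣r : gcd ∣ r
      gcd∣r = ∣-respʳ (≃-trans (≃-sym (scale≃const-*ₚ c m′)) (scale-inverse cc⁻¹≡1 r)) (∣⇒∣*ˡ (const c) gcd∣m′)
      gcd≃um+vf : gcd ≃ (v′ -ₚ v *ₚ h) *ₚ m +ₚ v *ₚ f
      gcd≃um+vf = ≃-trans gcd≃u′m′+v′m (≃-trans (+ₚ-cong u′m′≃vr (≃-refl {v′ *ₚ m})) (remainder-combination v v′ m f h r f-r≃hm))
        where
        u′m′≃vr : u′ *ₚ m′ ≃ v *ₚ r
        u′m′≃vr = ≃-trans (*ₚ-congʳ u′ (scale≃const-*ₚ c⁻¹ r)) (≃-sym (*ₚ-assoc u′ (const c⁻¹) r))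

  const-inverse : ∀ {c c⁻¹} → c * c⁻¹ ≡ 1# → ∀ x → const c⁻¹ *ₚ (const c *ₚ x) ≃ x
  const-inverse {c} {c⁻¹} cc⁻¹≡1 x = begin
    const c⁻¹ *ₚ (const c *ₚ x)  ≈⟨ ≃-sym (*ₚ-assoc (const c⁻¹) (const c) x) ⟩
    (const c⁻¹ *ₚ const c) *ₚ x  ≈⟨ *ₚ-congˡ x (≃-trans (const-*ₚ c⁻¹ c) (∷-cong (Eq.trans (FC.*-comm c⁻¹ c) cc⁻¹≡1) ≃-refl)) ⟩
    1ₚ *ₚ x                      ≈⟨ *ₚ-identityˡ x ⟩
    x                            ∎
    where open ≃-Reasoning

  irreducible⇒degree≥1 : ∀ {℘ d} → MonicIrreducible ℘ d → 1 ≤ d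
  irreducible⇒degree≥1 {d = suc d} _ = s≤s z≤n
  irreducible⇒degree≥1 {℘} {zero} (monic , _ , notUnit , _) =
    ⊥-elim (notUnit (1# , 1≢0 , at (LeadingTerm-0⇒≃const (monic⇒LeadingTerm {℘} monic))))

  irreducible-prime : ∀ {℘ d} → MonicIrreducible ℘ d → ∀ f g → ℘ ∣ f *ₚ g → ℘ ∣ f ⊎ ℘ ∣ g
  irreducible-prime {℘} (monic , _ , _ , factors) f g ℘∣fg with Division.m∣? ℘ monic f
  ... | yes ℘∣f = inj₁ ℘∣f
  ... | no ℘∤f  = inj₂ (gcd-unit⇒℘∣g (factors gcd w (at (≃-trans ℘≃w·gcd (*ₚ-comm w gcd)))))
    where
    open Bézout (monicBézout ℘ monic f)
    w = proj₁ gcd∣m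
    ℘≃w·gcd = proj₂ gcd∣m
    gcd-unit⇒℘∣g : IsUnit gcd ⊎ IsUnit w → ℘ ∣ g
    gcd-unit⇒℘∣g (inj₂ (c , c≢0 , w≈c)) = ⊥-elim (℘∤f (∣-trans ℘∣gcd gcd∣f))
      where
      ℘∣gcd : ℘ ∣ gcd
      ℘∣gcd = const _ , ≃-trans (≃-sym (const-inverse (proj₂ (inverse c c≢0)) gcd))
                          (*ₚ-congʳ (const _) (≃-sym (≃-trans ℘≃w·gcd (*ₚ-congˡ {w} gcd ⟨ w≈c ⟩))))
    gcd-unit⇒℘∣g (inj₁ (c , c≢0 , gcd≈c)) = ∣-respʳ g≃ (∣⇒∣*ˡ (const _) ℘∣[u℘+vf]g)
      where
      ℘∣[u℘+vf]g : ℘ ∣ (u *ₚ ℘ +ₚ v *ₚ f) *ₚ g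
      ℘∣[u℘+vf]g = ∣-respʳ (≃-sym (≃-trans (*ₚ-distribʳ g (u *ₚ ℘) (v *ₚ f)) (+ₚ-cong ≃-refl (*ₚ-assoc v f g))))
                     (∣-+ₚ (∣⇒∣*ʳ g (∣*ˡ u)) (∣⇒∣*ˡ v ℘∣fg))
      g≃ : const (proj₁ (inverse c c≢0)) *ₚ ((u *ₚ ℘ +ₚ v *ₚ f) *ₚ g) ≃ g
      g≃ = ≃-trans (*ₚ-congʳ (const _) (*ₚ-congˡ g (≃-trans (≃-sym gcd≃um+vf) (⟨_⟩ {gcd} gcd≈c))))
                   (const-inverse (proj₂ (inverse c c≢0)) g)

  irreducible∤const : ∀ {℘ d c} → MonicIrreducible ℘ d → c ≢ 0# → ¬ (℘ ∣ const c)
  irreducible∤const {℘} {d} mi c≢0 (h , c≃h℘) with ≃[]⊎degree h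
  ... | inj₁ h≃[]          = c≢0 (Eq.trans (at c≃h℘ 0) (at (*ₚ-zeroˡ ℘ h≃[]) 0))
  ... | inj₂ (i , _ , lh) = ℕP.<⇒≢ (ℕP.<-≤-trans (irreducible⇒degree≥1 {℘} mi) (ℕP.m≤n+m d i))
      (degree-unique (LeadingTerm-cong c≃h℘ (LeadingTerm-const c≢0)) (LeadingTerm-*ₚ lh (monic⇒LeadingTerm (proj₁ mi))))

  -- Residues modulo ℘ and Fermat's little theorem

  tail : Poly → Poly
  tail []      = []
  tail (a ∷ f) = f

  coeff-tail : ∀ f n → coeff (tail f) n ≡ coeff f (suc n)
  coeff-tail []      n = refl
  coeff-tail (a ∷ f) n = refl

  ≃-head∷tail : ∀ f → f ≃ coeff f 0 ∷ tail f
  ≃-head∷tail []      = ≃-sym (shift-≃[] ≃-refl)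
  ≃-head∷tail (a ∷ f) = ≃-refl

  -- the base-q number formed by the first d coefficients of f
  index : ∀ d → Poly → Fin (q ℕ.^ d)
  index zero    f = Fin.zero
  index (suc d) f = combine (Inverse.to enum (coeff f 0)) (index d (tail f))

  -- the polynomial with the base-q digits of i as its first d coefficients, followed by z
  fromIndex : ∀ d → Poly → Fin (q ℕ.^ d) → Poly
  fromIndex zero    z i = z
  fromIndex (suc d) z i = Inverse.from enum (proj₁ (remQuot {q} (q ℕ.^ d) i)) ∷ fromIndex d z (proj₂ (remQuot {q} (q ℕ.^ d) i))

  index-cong : ∀ d {f g} → f ≃ g → index d f ≡ index d g
  index-cong zero    f≃g = refl
  index-cong (suc d) {f} {g} ⟨ e ⟩ = cong₂ combine (cong (Inverse.to enum) (e 0))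
    (index-cong d ⟨ (λ n → Eq.trans (coeff-tail f n) (Eq.trans (e (suc n)) (Eq.sym (coeff-tail g n)))) ⟩)

  index-fromIndex : ∀ d z i → index d (fromIndex d z i) ≡ i
  index-fromIndex zero    z Fin.zero = refl
  index-fromIndex (suc d) z i = Eq.trans
    (cong₂ combine (Inverse.strictlyInverseˡ enum _) (index-fromIndex d z _))
    (FinP.combine-remQuot {q} (q ℕ.^ d) i)

  fromIndex-combine : ∀ d z a i → fromIndex (suc d) z (combine a i) ≡ Inverse.from enum a ∷ fromIndex d z i
  fromIndex-combine d z a i =
    cong (λ r → Inverse.from enum (proj₁ r) ∷ fromIndex d z (proj₂ r)) (FinP.remQuot-combine {q} {q ℕ.^ d} a i)

  fromIndex-index : ∀ d z f → (∀ n → coeff f (d ℕ.+ n) ≡ coeff z n) → fromIndex d z (index d f) ≃ f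
  fromIndex-index zero    z f f≈z   = ≃-sym ⟨ f≈z ⟩
  fromIndex-index (suc d) z f above = begin
    fromIndex (suc d) z (index (suc d) f)          ≈⟨ ≃-reflexive (fromIndex-combine d z _ (index d (tail f))) ⟩
    Inverse.from enum (Inverse.to enum (coeff f 0)) ∷ fromIndex d z (index d (tail f))
      ≈⟨ ∷-cong (Inverse.strictlyInverseʳ enum (coeff f 0))
                (fromIndex-index d z (tail f) (λ n → Eq.trans (coeff-tail f (d ℕ.+ n)) (above n))) ⟩
    coeff f 0 ∷ tail f                            ≈⟨ ≃-sym (≃-head∷tail f) ⟩
    f                                             ∎
    where open ≃-Reasoning

  coeff-fromIndex-above : ∀ d z i n → coeff (fromIndex d z i) (d ℕ.+ n) ≡ coeff z n
  coeff-fromIndex-above zero    z i n = refl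
  coeff-fromIndex-above (suc d) z i n = coeff-fromIndex-above d z _ n

  coeff-fromIndex-≥ : ∀ d z i {n} → d ≤ n → coeff (fromIndex d z i) n ≡ coeff z (n ℕ.∸ d)
  coeff-fromIndex-≥ d z i d≤n = Eq.trans (cong (coeff (fromIndex d z i)) (Eq.sym (ℕP.m+[n∸m]≡n d≤n)))
                                         (coeff-fromIndex-above d z i _)

  module Fermat (℘ : Poly) (d : ℕ) (irreducible : MonicIrreducible ℘ d) where
    open Division ℘ (proj₁ irreducible)

    infix 4 _≈℘_
    record _≈℘_ (f g : Poly) : Set where
      constructor mod℘
      field ℘∣f-g : ℘ ∣ f -ₚ g
    open _≈℘_

    ≈℘-refl : ∀ {f} → f ≈℘ f
    ≈℘-refl {f} = mod℘ (∣-respʳ (≃-sym (+ₚ-inverseʳ f)) ∣[])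

    ≈℘-sym : ∀ {f g} → f ≈℘ g → g ≈℘ f
    ≈℘-sym {f} {g} (mod℘ ℘∣f-g) = mod℘ (∣-respʳ (+ₚ-Properties.⁻¹-anti-homo‿- f g) (∣-negₚ ℘∣f-g))

    ≈℘-trans : ∀ {f g h} → f ≈℘ g → g ≈℘ h → f ≈℘ h
    ≈℘-trans {f} {g} {h} (mod℘ ℘∣f-g) (mod℘ ℘∣g-h) = mod℘ (∣-respʳ ([x-y]+[y+z]≃x+z f g (negₚ h)) (∣-+ₚ ℘∣f-g ℘∣g-h))

    ≃⇒≈℘ : ∀ {f g} → f ≃ g → f ≈℘ g
    ≃⇒≈℘ f≃g = mod℘ (∣-respʳ (≃-sym (+ₚ-Properties.x≈y⇒x∙y⁻¹≈ε f≃g)) ∣[])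

    ≈℘-*ₚ-congˡ : ∀ {f f′} g → f ≈℘ f′ → f *ₚ g ≈℘ f′ *ₚ g
    ≈℘-*ₚ-congˡ {f} {f′} g (mod℘ ℘∣f-f′) = mod℘ (∣-respʳ (*ₚ-distribʳ-ₚ g f f′) (∣⇒∣*ʳ g ℘∣f-f′))

    ≈℘-*ₚ-cong : ∀ {f f′ g g′} → f ≈℘ f′ → g ≈℘ g′ → f *ₚ g ≈℘ f′ *ₚ g′
    ≈℘-*ₚ-cong {f} {f′} {g} {g′} f≈f′ g≈g′ =
      ≈℘-trans (≈℘-*ₚ-congˡ g f≈f′) (≈℘-trans (≃⇒≈℘ (*ₚ-comm f′ g))
        (≈℘-trans (≈℘-*ₚ-congˡ f′ g≈g′) (≃⇒≈℘ (*ₚ-comm g′ f′))))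

    ℘∣-resp-≈℘ : ∀ {f g} → f ≈℘ g → ℘ ∣ f → ℘ ∣ g
    ℘∣-resp-≈℘ {f} {g} (mod℘ ℘∣f-g) ℘∣f = ∣-respʳ (x-[x-y]≃y f g) (∣--ₚ ℘∣f ℘∣f-g)

    rem-≈℘ : ∀ f → rem f ≈℘ f
    rem-≈℘ f = ≈℘-sym (mod℘ (m∣f-rem f))

    *ₚ-mod℘-commutativeMonoid : CommutativeMonoid _ _
    *ₚ-mod℘-commutativeMonoid = record
      { Carrier = Poly ; _≈_ = _≈℘_ ; _∙_ = _*ₚ_ ; ε = 1ₚ
      ; isCommutativeMonoid = record
        { isMonoid = record
          { isSemigroup = record
            { isMagma = record
              { isEquivalence = record { refl = ≈℘-refl ; sym = ≈℘-sym ; trans = ≈℘-trans }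
              ; ∙-cong = ≈℘-*ₚ-cong }
            ; assoc = λ f g h → ≃⇒≈℘ (*ₚ-assoc f g h) }
          ; identity = (λ f → ≃⇒≈℘ (*ₚ-identityˡ f)) , (λ f → ≃⇒≈℘ (*ₚ-identityʳ f)) }
        ; comm = λ f g → ≃⇒≈℘ (*ₚ-comm f g) } }

    open CommutativeMonoidSum *ₚ-mod℘-commutativeMonoid
      using (sum-cong-≋; sum-remove; sum-replicate; sum-replicate-zero; ∑-distrib-+; sum-permute)
      renaming (sum to ∏)

    ℘∤1 : ¬ ℘ ∣ 1ₚ
    ℘∤1 = irreducible∤const irreducible 1≢0

    ℘∤∏ : ∀ {n} (f : Fin n → Poly) → (∀ i → ¬ ℘ ∣ f i) → ¬ ℘ ∣ ∏ f
    ℘∤∏ {zero}  f ℘∤f = ℘∤1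
    ℘∤∏ {suc n} f ℘∤f ℘∣∏f with irreducible-prime irreducible (f Fin.zero) (∏ (f ∘ Fin.suc)) ℘∣∏f
    ... | inj₁ ℘∣f₀ = ℘∤f Fin.zero ℘∣f₀
    ... | inj₂ ℘∣∏  = ℘∤∏ (f ∘ Fin.suc) (℘∤f ∘ Fin.suc) ℘∣∏

    ∏-single : ∀ {n} (f : Fin n → Poly) i → (∀ j → j ≢ i → f j ≈℘ 1ₚ) → ∏ f ≈℘ f i
    ∏-single {suc n} f i others≈1 = ≈℘-trans (sum-remove {i = i} f)
      (≈℘-trans (≈℘-*ₚ-cong (≈℘-refl {f i})
                  (≈℘-trans (sum-cong-≋ (λ j → others≈1 (Fin.punchIn i j) (FinP.punchInᵢ≢i i j))) (sum-replicate-zero n)))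
                (≃⇒≈℘ (*ₚ-identityʳ (f i))))

    N : ℕ
    N = q ℕ.^ d

    residue : Fin N → Poly
    residue = fromIndex d []

    residue-degreeBelow : ∀ i → DegreeBelow (residue i) d
    residue-degreeBelow i n d≤n = coeff-fromIndex-≥ d [] i d≤n

    residue-index : ∀ {f} → DegreeBelow f d → residue (index d f) ≃ f
    residue-index {f} below = fromIndex-index d [] f (λ n → below (d ℕ.+ n) (ℕP.m≤m+n d n))

    residue-injective : ∀ {i j} → residue i ≈℘ residue j → i ≡ j
    residue-injective {i} {j} (mod℘ ℘∣ri-rj) = begin
      i                            ≡⟨ Eq.sym (index-fromIndex d [] i) ⟩
      index d (residue i)          ≡⟨ index-cong d (+ₚ-Properties.x∙y⁻¹≈ε⇒x≈y _ _ ri-rj≃[]) ⟩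
      index d (residue j)          ≡⟨ index-fromIndex d [] j ⟩
      j                            ∎
      where
      open Eq.≡-Reasoning
      ri-rj≃[] = ∣∧degree<⇒≃[] ℘∣ri-rj (monic⇒LeadingTerm (proj₁ irreducible))
                   (-ₚ-degreeBelow (residue i) (residue j) (residue-degreeBelow i) (residue-degreeBelow j))

    zeroResidue : Fin N
    zeroResidue = index d []

    residue-zeroResidue : residue zeroResidue ≃ []
    residue-zeroResidue = residue-index (λ _ _ → refl)

    ℘∣residue⇒zeroResidue : ∀ {i} → ℘ ∣ residue i → i ≡ zeroResidue
    ℘∣residue⇒zeroResidue {i} ℘∣rᵢ = residue-injective (mod℘ (∣-respʳ ri≃ri-r₀ ℘∣rᵢ))
      where
      ri≃ri-r₀ : residue i ≃ residue i -ₚ residue zeroResidue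
      ri≃ri-r₀ = ≃-sym (≃-trans (+ₚ-cong (≃-refl {residue i}) (negₚ-cong residue-zeroResidue)) (+ₚ-identityʳ _))

    -- f, or 1 when ℘ ∣ f; the product of these over all residues is prime to ℘
    nonzeroPart : Poly → Poly
    nonzeroPart f with m∣? f
    ... | yes _ = 1ₚ
    ... | no _  = f

    ℘∤nonzeroPart : ∀ f → ¬ ℘ ∣ nonzeroPart f
    ℘∤nonzeroPart f with m∣? f
    ... | yes _  = ℘∤1
    ... | no ℘∤f = ℘∤f

    nonzeroPart-cong : ∀ {f g} → f ≈℘ g → nonzeroPart f ≈℘ nonzeroPart g
    nonzeroPart-cong {f} {g} f≈g with m∣? f | m∣? g
    ... | yes _    | yes _    = ≈℘-refl
    ... | yes ℘∣f  | no ℘∤g   = ⊥-elim (℘∤g (℘∣-resp-≈℘ f≈g ℘∣f))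
    ... | no ℘∤f   | yes ℘∣g  = ⊥-elim (℘∤f (℘∣-resp-≈℘ (≈℘-sym f≈g) ℘∣g))
    ... | no _     | no _     = f≈g

    module Coprime (x : Poly) (℘∤x : ¬ ℘ ∣ x) where

      σ : Fin N → Fin N
      σ i = index d (rem (x *ₚ residue i))

      residue-σ : ∀ i → residue (σ i) ≈℘ x *ₚ residue i
      residue-σ i = ≈℘-trans (≃⇒≈℘ (residue-index (rem-degreeBelow (x *ₚ residue i)))) (rem-≈℘ (x *ₚ residue i))

      σ-injective : ∀ {i j} → σ i ≡ σ j → i ≡ j
      σ-injective {i} {j} σi≡σj with irreducible-prime irreducible x (residue i -ₚ residue j) ℘∣x[ri-rj]
        where
        xri≈xrj : x *ₚ residue i ≈℘ x *ₚ residue j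
        xri≈xrj = ≈℘-trans (≈℘-sym (residue-σ i)) (≈℘-trans (≃⇒≈℘ (≃-reflexive (cong residue σi≡σj))) (residue-σ j))
        ℘∣x[ri-rj] : ℘ ∣ x *ₚ (residue i -ₚ residue j)
        ℘∣x[ri-rj] = ∣-respʳ (≃-sym (*ₚ-distribˡ-ₚ x (residue i) (residue j))) (℘∣f-g xri≈xrj)
      ... | inj₁ ℘∣x       = ⊥-elim (℘∤x ℘∣x)
      ... | inj₂ ℘∣ri-rj   = residue-injective (mod℘ ℘∣ri-rj)

      σ-permutation : Permutation N N
      σ-permutation = permutation σ (proj₁ ∘ σ-surjective) (proj₂ ∘ σ-surjective)
                        (λ i → σ-injective (proj₂ (σ-surjective (σ i))))
        where σ-surjective = injective⇒surjective σ σ-injective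

      -- x at the zero residue, where nonzeroPart (x · 0) = 1 falls short of x · nonzeroPart 0 = x
      correction : Fin N → Poly
      correction i with m∣? (residue i)
      ... | yes _ = x
      ... | no _  = 1ₚ

      nonzeroPart-x*residue : ∀ i → nonzeroPart (x *ₚ residue i) *ₚ correction i ≈℘ x *ₚ nonzeroPart (residue i)
      nonzeroPart-x*residue i with m∣? (residue i) | m∣? (x *ₚ residue i)
      ... | yes _    | yes _     = ≃⇒≈℘ (*ₚ-comm 1ₚ x)
      ... | yes ℘∣rᵢ | no ℘∤xrᵢ  = ⊥-elim (℘∤xrᵢ (∣⇒∣*ˡ x ℘∣rᵢ))
      ... | no ℘∤rᵢ  | yes ℘∣xrᵢ with irreducible-prime irreducible x (residue i) ℘∣xrᵢ
      ...   | inj₁ ℘∣x  = ⊥-elim (℘∤x ℘∣x)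
      ...   | inj₂ ℘∣rᵢ = ⊥-elim (℘∤rᵢ ℘∣rᵢ)
      nonzeroPart-x*residue i | no _ | no _ = ≃⇒≈℘ (*ₚ-identityʳ (x *ₚ residue i))

      ∏-correction : ∏ correction ≈℘ x
      ∏-correction = ≈℘-trans (∏-single correction zeroResidue correction≈1) correction-zeroResidue
        where
        correction≈1 : ∀ j → j ≢ zeroResidue → correction j ≈℘ 1ₚ
        correction≈1 j j≢0 with m∣? (residue j)
        ... | yes ℘∣rⱼ = ⊥-elim (j≢0 (℘∣residue⇒zeroResidue ℘∣rⱼ))
        ... | no _     = ≈℘-refl
        correction-zeroResidue : correction zeroResidue ≈℘ x
        correction-zeroResidue with m∣? (residue zeroResidue)
        ... | yes _    = ≈℘-refl
        ... | no ℘∤r₀  = ⊥-elim (℘∤r₀ (∣-respʳ (≃-sym residue-zeroResidue) ∣[]))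

      P : Poly
      P = ∏ (nonzeroPart ∘ residue)

      P*x≈x^N*P : P *ₚ x ≈℘ x ^ₚ N *ₚ P
      P*x≈x^N*P = begin
        P *ₚ x
          ≈⟨ ≈℘-*ₚ-cong (≈℘-trans (sum-permute (nonzeroPart ∘ residue) σ-permutation)
                                    (sum-cong-≋ {N} (nonzeroPart-cong ∘ residue-σ)))
                        (≈℘-sym ∏-correction) ⟩
        ∏ (λ i → nonzeroPart (x *ₚ residue i)) *ₚ ∏ correction
          ≈⟨ ≈℘-sym (∑-distrib-+ {N} (λ i → nonzeroPart (x *ₚ residue i)) correction) ⟩
        ∏ (λ i → nonzeroPart (x *ₚ residue i) *ₚ correction i)
          ≈⟨ sum-cong-≋ {N} nonzeroPart-x*residue ⟩
        ∏ (λ i → x *ₚ nonzeroPart (residue i))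
          ≈⟨ ∑-distrib-+ {N} (λ _ → x) (nonzeroPart ∘ residue) ⟩
        ∏ {N} (λ _ → x) *ₚ P                  ≈⟨ ≈℘-*ₚ-congˡ P (sum-replicate N) ⟩
        N ×ₘ x *ₚ P                           ≡⟨ cong (_*ₚ P) (×≡^ₚ N) ⟩
        x ^ₚ N *ₚ P                           ∎
        where
        open SetoidReasoning (CommutativeMonoid.setoid *ₚ-mod℘-commutativeMonoid)
        open import Algebra.Definitions.RawMonoid (CommutativeMonoid.rawMonoid *ₚ-mod℘-commutativeMonoid) renaming (_×_ to _×ₘ_)
        ×≡^ₚ : ∀ n → n ×ₘ x ≡ x ^ₚ n
        ×≡^ₚ zero    = refl
        ×≡^ₚ (suc n) = cong (x *ₚ_) (×≡^ₚ n)

      ℘∣P[x-x^N] : ℘ ∣ P *ₚ (x -ₚ x ^ₚ N)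
      ℘∣P[x-x^N] = ∣-respʳ {℘} {P *ₚ x -ₚ x ^ₚ N *ₚ P} {P *ₚ (x -ₚ x ^ₚ N)}
                   (≃-trans (+ₚ-cong (≃-refl {P *ₚ x}) (negₚ-cong (*ₚ-comm (x ^ₚ N) P)))
                            (≃-sym (*ₚ-distribˡ-ₚ P x (x ^ₚ N))))
                            (℘∣f-g P*x≈x^N*P)

      fermat-coprime : ℘ ∣ x ^ₚ N -ₚ x
      fermat-coprime = [ (λ ℘∣P → ⊥-elim (℘∤∏ {N} (nonzeroPart ∘ residue) (℘∤nonzeroPart ∘ residue) ℘∣P))
                       , (λ ℘∣x-x^N → ∣-respʳ {℘} {negₚ (x -ₚ x ^ₚ N)} {x ^ₚ N -ₚ x}
                                        (+ₚ-Properties.⁻¹-anti-homo‿- x (x ^ₚ N)) (∣-negₚ ℘∣x-x^N)) ]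
                       (irreducible-prime irreducible P (x -ₚ x ^ₚ N) ℘∣P[x-x^N])

    fermat : ∀ x → ℘ ∣ x ^ₚ N -ₚ x
    fermat x = by-cases (m∣? x)
      where
      by-cases : Dec (℘ ∣ x) → ℘ ∣ x ^ₚ N -ₚ x
      by-cases (no ℘∤x)  = Coprime.fermat-coprime x ℘∤x
      by-cases (yes ℘∣x) = ℘∣x^n-x N (FinP.nonZeroIndex zeroResidue)
        where
        ℘∣x^n-x : ∀ n → NonZero n → ℘ ∣ x ^ₚ n -ₚ x
        ℘∣x^n-x (suc n) _ = ∣--ₚ (∣⇒∣*ʳ (x ^ₚ n) ℘∣x) ℘∣x

  -- Characteristic p: Frobenius and p-th roots

  instance
    p-nonZero : NonZero p
    p-nonZero = prime⇒nonZero p-prime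

  cast-mod : ∀ m → cast m ≡ cast (m % p)
  cast-mod m = Eq.trans (cong cast (m≡m%n+[m/n]*n m p))
    (Eq.trans (cast-+ (m % p) ((m / p) ℕ.* p)) (Eq.trans (cong (cast (m % p) +_) (cast-*p (m / p))) (FC.+-identityʳ _)))

  cast-∣ : ∀ {m} → p ∣ℕ m → cast m ≡ 0#
  cast-∣ p∣m = Eq.trans (cong cast (ℕ∣.m∣n⇒n≡quotient*m p∣m)) (cast-*p (ℕ∣.quotient p∣m))

  -- a Bézout identity 1 + y r = x p (or its mirror) would force 1 = 0 in F
  cast-∤ : ∀ {m} → ¬ p ∣ℕ m → cast m ≢ 0#
  cast-∤ {m} p∤m cast-m≡0 with coprime-Bézout (prime⇒coprime p-prime {{ℕ.≢-nonZero r≢0}} (m%n<n m p))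
    where
    r≢0 : m % p ≢ 0
    r≢0 r≡0 = p∤m (ℕ∣.m%n≡0⇒n∣m m p r≡0)
  ... | ℕ-Bézout.+- x y 1+yr≡xp = 1≢0 (begin
      1#                       ≡⟨ Eq.sym (FC.+-identityʳ 1#) ⟩
      1# + 0#                  ≡⟨ cong (1# +_) (Eq.sym (Eq.trans (cong (cast y *_) cast-r≡0) (FC.zeroʳ (cast y)))) ⟩
      1# + cast y * cast (m % p)  ≡⟨ cong (1# +_) (Eq.sym (cast-* y (m % p))) ⟩
      cast (1 ℕ.+ y ℕ.* (m % p))  ≡⟨ cong cast 1+yr≡xp ⟩
      cast (x ℕ.* p)           ≡⟨ cast-*p x ⟩
      0#                       ∎)
    where
    open Eq.≡-Reasoning
    cast-r≡0 = Eq.trans (Eq.sym (cast-mod m)) cast-m≡0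
  ... | ℕ-Bézout.-+ x y 1+xp≡yr = 1≢0 (begin
      1#                       ≡⟨ Eq.sym (FC.+-identityʳ 1#) ⟩
      1# + 0#                  ≡⟨ cong (1# +_) (Eq.sym (cast-*p x)) ⟩
      cast (1 ℕ.+ x ℕ.* p)     ≡⟨ cong cast 1+xp≡yr ⟩
      cast (y ℕ.* (m % p))     ≡⟨ cast-* y (m % p) ⟩
      cast y * cast (m % p)    ≡⟨ cong (cast y *_) (Eq.trans (Eq.sym (cast-mod m)) cast-m≡0) ⟩
      cast y * 0#              ≡⟨ FC.zeroʳ (cast y) ⟩
      0#                       ∎)
    where open Eq.≡-Reasoning

  ∂-^-cast≡0 : ∀ f n → cast n ≡ 0# → ∂ (f ^ₚ n) ≃ []
  ∂-^-cast≡0 f zero    _          = ≃-refl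
  ∂-^-cast≡0 f (suc n) cast-n≡0 = ≃-trans (∂-^ f n) (≃-trans (scale-cong cast-n≡0 ≃-refl) (scale-zero _))

  ∂-^p : ∀ f → ∂ (f ^ₚ p) ≃ []
  ∂-^p f = ∂-^-cast≡0 f p char-p

  module PolyBinomial = BinomialProperties (CommutativeRing.commutativeSemiring Poly-ring)
  module PolyExp = CommutativeSemiringExp (CommutativeRing.commutativeSemiring Poly-ring)
  module PolySum = SemiringSum (CommutativeRing.semiring Poly-ring)
  open SemiringMult (CommutativeRing.semiring Poly-ring) using () renaming (_×_ to _×ₚ_)
  open SemiringExp (CommutativeRing.semiring Poly-ring) using () renaming (_^_ to _^ₛ_)

  ×ₚ≃scale-cast : ∀ n f → n ×ₚ f ≃ scale (cast n) f
  ×ₚ≃scale-cast zero    f = ≃-sym (scale-zero f)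
  ×ₚ≃scale-cast (suc n) f = ≃-trans (+ₚ-cong (≃-sym (scale-one f)) (×ₚ≃scale-cast n f)) (≃-sym (scale-distribˡ 1# (cast n) f))

  ^ₛ≡^ₚ : ∀ n f → f ^ₛ n ≡ f ^ₚ n
  ^ₛ≡^ₚ zero    f = refl
  ^ₛ≡^ₚ (suc n) f = cong (f *ₚ_) (^ₛ≡^ₚ n f)

  freshmansDream : ∀ m → (∀ j → 0 < j → j < suc m → cast (suc m C j) ≡ 0#) →
             ∀ f g → (f +ₚ g) ^ₚ suc m ≃ f ^ₚ suc m +ₚ g ^ₚ suc m
  freshmansDream m inner≡0 f g = begin
    (f +ₚ g) ^ₚ n                                  ≈⟨ ≃-reflexive (Eq.sym (^ₛ≡^ₚ n (f +ₚ g))) ⟩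
    (f +ₚ g) ^ₛ n                                  ≈⟨ PolyBinomial.theorem n f g ⟩
    term Fin.zero +ₚ ∑ (term ∘ Fin.suc)            ≈⟨ +ₚ-cong (≃-refl {term Fin.zero}) (PolySum.sum-init-last (term ∘ Fin.suc)) ⟩
    term Fin.zero +ₚ (∑ (term ∘ Fin.suc ∘ Fin.inject₁) +ₚ term (Fin.suc (Fin.fromℕ m)))
      ≈⟨ +ₚ-cong (≃-refl {term Fin.zero}) (+ₚ-cong (≃-trans (PolySum.sum-cong-≋ {m} inner≃[]) (PolySum.sum-replicate-zero m))
                                                    (≃-refl {term (Fin.suc (Fin.fromℕ m))})) ⟩
    term Fin.zero +ₚ ([] +ₚ term (Fin.suc (Fin.fromℕ m)))   ≈⟨ +ₚ-cong first≃g^n last≃f^n ⟩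
    g ^ₚ n +ₚ f ^ₚ n                               ≈⟨ +ₚ-comm (g ^ₚ n) (f ^ₚ n) ⟩
    f ^ₚ n +ₚ g ^ₚ n                               ∎
    where
    open ≃-Reasoning
    open PolySum using () renaming (sum to ∑)
    n = suc m
    term : Fin (suc n) → Poly
    term = PolyBinomial.binomialTerm f g n
    inner≃[] : ∀ i → term (Fin.suc (Fin.inject₁ i)) ≃ []
    inner≃[] i = ≃-trans (×ₚ≃scale-cast (n C j) b) (≃-trans (scale-cong (inner≡0 j (s≤s z≤n) j<n) (≃-refl {b})) (scale-zero b))
      where
      j = suc (toℕ (Fin.inject₁ i))
      b = PolyBinomial.binomial f g n (Fin.suc (Fin.inject₁ i))
      j<n = s≤s (Eq.subst (_< m) (Eq.sym (FinP.toℕ-inject₁ i)) (FinP.toℕ<n i))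
    first≃g^n : term Fin.zero ≃ g ^ₚ n
    first≃g^n = begin
      (n C 0) ×ₚ (1ₚ *ₚ g ^ₛ n)    ≈⟨ ≃-reflexive (cong (_×ₚ (1ₚ *ₚ g ^ₛ n)) (Eq.trans (nCk≡nC[n∸k] {0} {n} z≤n) (nCn≡1 n))) ⟩
      (1ₚ *ₚ g ^ₛ n) +ₚ []         ≈⟨ ≃-trans (+ₚ-identityʳ _) (*ₚ-identityˡ _) ⟩
      g ^ₛ n                       ≈⟨ ≃-reflexive (^ₛ≡^ₚ n g) ⟩
      g ^ₚ n                       ∎
    last≃f^n : [] +ₚ term (Fin.suc (Fin.fromℕ m)) ≃ f ^ₚ n
    last≃f^n = begin
      term (Fin.suc (Fin.fromℕ m))                  ≈⟨ ≃-reflexive (cong (λ j → (n C suc j) ×ₚ (f ^ₛ suc j *ₚ g ^ₛ (n ∸ suc j))) (FinP.toℕ-fromℕ m)) ⟩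
      (n C n) ×ₚ (f ^ₛ n *ₚ g ^ₛ (n ∸ n))           ≈⟨ ≃-reflexive (cong (_×ₚ (f ^ₛ n *ₚ g ^ₛ (n ∸ n))) (nCn≡1 n)) ⟩
      (f ^ₛ n *ₚ g ^ₛ (n ∸ n)) +ₚ []                ≈⟨ +ₚ-identityʳ _ ⟩
      f ^ₛ n *ₚ g ^ₛ (n ∸ n)                        ≈⟨ *ₚ-congʳ (f ^ₛ n) (≃-reflexive (cong (g ^ₛ_) (ℕP.n∸n≡0 n))) ⟩
      f ^ₛ n *ₚ 1ₚ                                  ≈⟨ *ₚ-identityʳ _ ⟩
      f ^ₛ n                                        ≈⟨ ≃-reflexive (^ₛ≡^ₚ n f) ⟩
      f ^ₚ n                                        ∎

  frobenius : ∀ f g → (f +ₚ g) ^ₚ p ≃ f ^ₚ p +ₚ g ^ₚ p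
  frobenius = Eq.subst (λ n → ∀ f g → (f +ₚ g) ^ₚ n ≃ f ^ₚ n +ₚ g ^ₚ n) (ℕP.suc-pred p)
    (freshmansDream (ℕ.pred p) (λ j 0<j j<p → cast-∣ (Eq.subst (λ n → p ∣ℕ n C j) (Eq.sym (ℕP.suc-pred p))
                                          (prime∣pCk p-prime 0<j (Eq.subst (j <_) (ℕP.suc-pred p) j<p)))))

  factor-degrees : ∀ {f g h n c} → LeadingTerm f n c → f ≃ g *ₚ h →
                   Σ ℕ λ i → Σ ℕ λ j → HasDegree g i × HasDegree h j × i ℕ.+ j ≡ n
  factor-degrees {f} {g} {h} lf f≃gh with ≃[]⊎degree g | ≃[]⊎degree h
  ... | inj₁ g≃[] | _ = ⊥-elim (LeadingTerm⇒≄[] lf (≃-trans f≃gh (*ₚ-zeroˡ h g≃[])))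
  ... | inj₂ _ | inj₁ h≃[] = ⊥-elim (LeadingTerm⇒≄[] lf (≃-trans f≃gh (≃-trans (*ₚ-comm g h) (*ₚ-zeroˡ g h≃[]))))
  ... | inj₂ (i , c , lg) | inj₂ (j , d , lh) =
    i , j , (c , lg) , (d , lh) , degree-unique (LeadingTerm-*ₚ lg lh) (LeadingTerm-cong f≃gh lf)

  degree0⇒unit : ∀ {g} → HasDegree g 0 → IsUnit g
  degree0⇒unit (c , lg) = c , leading≢0 lg , at (LeadingTerm-0⇒≃const lg)

  unit⇒degree0 : ∀ {g i} → IsUnit g → HasDegree g i → i ≡ 0
  unit⇒degree0 (c , c≢0 , g≈c) (_ , lg) = degree-unique lg (LeadingTerm-cong (≃-sym ⟨ g≈c ⟩) (LeadingTerm-const c≢0))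

  degree1⇒irreducible : ∀ {f} → MonicOfDegree f 1 → Irreducible f
  degree1⇒irreducible {f} monic =
      (λ f≈[] → LeadingTerm⇒≄[] lf ⟨ f≈[] ⟩)
    , (λ unit → ℕP.1+n≢0 (unit⇒degree0 unit (1# , lf)))
    , factors
    where
    lf = monic⇒LeadingTerm {f} monic
    factors : ∀ g h → f ≈ g *ₚ h → IsUnit g ⊎ IsUnit h
    factors g h f≈gh with factor-degrees {g = g} {h} lf ⟨ f≈gh ⟩
    ... | zero    , _      , dg , _  , _     = inj₁ (degree0⇒unit dg)
    ... | suc _   , zero   , _  , dh , _     = inj₂ (degree0⇒unit dh)
    ... | suc i   , suc j  , _  , _  , i+j≡0 = ⊥-elim (ℕP.1+n≢0 (ℕP.suc-injective (Eq.trans (cong suc (Eq.sym (ℕP.+-suc i j))) i+j≡0)))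

  tₚ-irreducible : MonicIrreducible tₚ 1
  tₚ-irreducible = t-monic , degree1⇒irreducible {tₚ} t-monic
    where
    t-monic : MonicOfDegree tₚ 1
    t-monic = refl , λ { (suc (suc n)) _ → refl ; (suc zero) (s≤s ()) }

  open SemiringExp FC.semiring using (^-assocʳ) renaming (_^_ to _^F_)

  const-^ₚ : ∀ x n → const x ^ₚ n ≃ const (x ^F n)
  const-^ₚ x zero    = ≃-refl
  const-^ₚ x (suc n) = ≃-trans (*ₚ-congʳ (const x) (const-^ₚ x n)) (const-*ₚ x (x ^F n))

  -- Fermat modulo t, read off at the constant coefficient
  ^q-F : ∀ x → x ^F q ≡ x
  ^q-F x = +F-Properties.x∙y⁻¹≈ε⇒x≈y _ _ (begin
    x ^F q + - x                                    ≡⟨ cong₂ _+_ (cong (x ^F_) (Eq.sym (ℕP.*-identityʳ q))) refl ⟩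
    x ^F (q ℕ.* 1) + - x                            ≡⟨ Eq.sym (cong₂ _+_ (at (const-^ₚ x (q ℕ.* 1)) 0) (coeff-neg (const x) 0)) ⟩
    coeff (const x ^ₚ (q ℕ.* 1)) 0 + coeff (negₚ (const x)) 0  ≡⟨ Eq.sym (coeff-+ (const x ^ₚ (q ℕ.* 1)) _ 0) ⟩
    coeff (const x ^ₚ (q ℕ.* 1) -ₚ const x) 0       ≡⟨ at (proj₂ t∣) 0 ⟩
    coeff (proj₁ t∣ *ₚ tₚ) 0                        ≡⟨ at (*ₚ-comm (proj₁ t∣) tₚ) 0 ⟩
    coeff (tₚ *ₚ proj₁ t∣) 0                        ≡⟨ coeff-*-∷ 0# (1# ∷ []) (proj₁ t∣) 0 ⟩
    0# * coeff (proj₁ t∣) 0 + 0#                    ≡⟨ Eq.trans (FC.+-identityʳ _) (FC.zeroˡ _) ⟩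
    0#                                              ∎)
    where
    open Eq.≡-Reasoning
    module +F-Properties = GroupProperties FC.+-group
    t∣ = Fermat.fermat tₚ 1 tₚ-irreducible (const x)

  p∣q : p ∣ℕ q
  p∣q = Eq.subst (p ∣ℕ_) (Eq.sym q≡p^k) (p∣p^k k k≢0)
    where
    p∣p^k : ∀ k → k ≢ 0 → p ∣ℕ p ℕ.^ k
    p∣p^k zero    0≢0 = ⊥-elim (0≢0 refl)
    p∣p^k (suc k) _   = ℕ∣.m∣m*n (p ℕ.^ k)
    Fin1-trivial : ∀ {n} → n ≡ 1 → (i j : Fin n) → i ≡ j
    Fin1-trivial refl Fin.zero Fin.zero = refl
    -- if k = 0 then F has a single element, contradicting 0 ≢ 1
    k≢0 : k ≢ 0
    k≢0 k≡0 = 0≢1 (begin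
      0#                                    ≡⟨ Eq.sym (Inverse.strictlyInverseʳ enum 0#) ⟩
      Inverse.from enum (Inverse.to enum 0#) ≡⟨ cong (Inverse.from enum) (Fin1-trivial q≡1 _ _) ⟩
      Inverse.from enum (Inverse.to enum 1#) ≡⟨ Inverse.strictlyInverseʳ enum 1# ⟩
      1#                                    ∎)
      where
      open Eq.≡-Reasoning
      q≡1 = Eq.trans q≡p^k (cong (p ℕ.^_) k≡0)

  cast-q^d : ∀ d → 1 ≤ d → cast (q ℕ.^ d) ≡ 0#
  cast-q^d (suc d) _ = cast-∣ (ℕ∣.∣-trans p∣q (ℕ∣.m∣m*n (q ℕ.^ d)))

  pthRoot-F : ∀ x → Σ F (λ r → r ^F p ≡ x)
  pthRoot-F x = x ^F ℕ∣.quotient p∣q , (begin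
    (x ^F ℕ∣.quotient p∣q) ^F p   ≡⟨ ^-assocʳ x (ℕ∣.quotient p∣q) p ⟩
    x ^F (ℕ∣.quotient p∣q ℕ.* p)  ≡⟨ cong (x ^F_) (Eq.sym (ℕ∣.m∣n⇒n≡quotient*m p∣q)) ⟩
    x ^F q                        ≡⟨ ^q-F x ⟩
    x                             ∎)
    where open Eq.≡-Reasoning

  InF[tᵖ] : Poly → Set
  InF[tᵖ] f = ∀ n → ¬ p ∣ℕ n → coeff f n ≡ 0#

  ∂≃[]⇒InF[tᵖ] : ∀ {f} → ∂ f ≃ [] → InF[tᵖ] f
  ∂≃[]⇒InF[tᵖ] ∂f≃[] zero    p∤0 = ⊥-elim (p∤0 (p ℕ∣.∣0))
  ∂≃[]⇒InF[tᵖ] {f} ∂f≃[] (suc n) p∤n with coeff f (suc n) ≟ 0#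
  ... | yes fₙ≡0 = fₙ≡0
  ... | no fₙ≢0  = ⊥-elim (x*y≢0 (cast-∤ p∤n) fₙ≢0 (Eq.trans (Eq.sym (coeff-∂ f n)) (at ∂f≃[] n)))

  coeff-drop : ∀ m f n → coeff (drop m f) n ≡ coeff f (m ℕ.+ n)
  coeff-drop zero    f       n = refl
  coeff-drop (suc m) []      n = refl
  coeff-drop (suc m) (a ∷ f) n = coeff-drop m f n

  InF[tᵖ]-drop : ∀ {f} → InF[tᵖ] f → InF[tᵖ] (drop p f)
  InF[tᵖ]-drop {f} f∈ n p∤n = Eq.trans (coeff-drop p f n) (f∈ (p ℕ.+ n) (λ p∣p+n → p∤n (ℕ∣.∣m+n∣m⇒∣n p∣p+n ℕ∣.∣-refl)))

  tₚ*≃shift : ∀ g → tₚ *ₚ g ≃ shift g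
  tₚ*≃shift g = +ₚ-cong (scale-zero g) (∷-cong refl (*ₚ-identityˡ g))

  coeff-tᵐ*-< : ∀ m g {n} → n < m → coeff (tₚ ^ₚ m *ₚ g) n ≡ 0#
  coeff-tᵐ*-< (suc m) g {zero}  _ = Eq.trans (at (*ₚ-assoc tₚ (tₚ ^ₚ m) g) 0) (at (tₚ*≃shift (tₚ ^ₚ m *ₚ g)) 0)
  coeff-tᵐ*-< (suc m) g {suc n} (s≤s n<m) =
    Eq.trans (at (≃-trans (*ₚ-assoc tₚ (tₚ ^ₚ m) g) (tₚ*≃shift (tₚ ^ₚ m *ₚ g))) (suc n)) (coeff-tᵐ*-< m g n<m)

  coeff-tᵐ*-≥ : ∀ m g n → coeff (tₚ ^ₚ m *ₚ g) (m ℕ.+ n) ≡ coeff g n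
  coeff-tᵐ*-≥ zero    g n = at (*ₚ-identityˡ g) n
  coeff-tᵐ*-≥ (suc m) g n =
    Eq.trans (at (≃-trans (*ₚ-assoc tₚ (tₚ ^ₚ m) g) (tₚ*≃shift (tₚ ^ₚ m *ₚ g))) (suc (m ℕ.+ n))) (coeff-tᵐ*-≥ m g n)

  InF[tᵖ]-split : ∀ {f} → InF[tᵖ] f → f ≃ const (coeff f 0) +ₚ tₚ ^ₚ p *ₚ drop p f
  InF[tᵖ]-split {f} f∈ = ⟨ (λ n → Eq.sym (Eq.trans (coeff-+ (const (coeff f 0)) (tₚ ^ₚ p *ₚ drop p f) n) (by-cases n (ℕP.<-≤-connex n p)))) ⟩
    where
    by-cases : ∀ n → n < p ⊎ p ≤ n → coeff (const (coeff f 0)) n + coeff (tₚ ^ₚ p *ₚ drop p f) n ≡ coeff f n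
    by-cases zero    (inj₁ 0<p) = Eq.trans (cong (coeff f 0 +_) (coeff-tᵐ*-< p (drop p f) 0<p)) (FC.+-identityʳ _)
    by-cases (suc n) (inj₁ n<p) = Eq.trans (FC.+-identityˡ _) (Eq.trans (coeff-tᵐ*-< p (drop p f) n<p)
                                    (Eq.sym (f∈ (suc n) (λ p∣n → ℕP.<⇒≱ n<p (ℕ∣.∣⇒≤ p∣n)))))
    by-cases n       (inj₂ p≤n) = begin
      coeff (const (coeff f 0)) n + coeff (tₚ ^ₚ p *ₚ drop p f) n
        ≡⟨ cong₂ _+_ (const-above n p≤n) (cong (coeff (tₚ ^ₚ p *ₚ drop p f)) (Eq.sym n≡p+[n-p])) ⟩
      0# + coeff (tₚ ^ₚ p *ₚ drop p f) (p ℕ.+ (n ∸ p))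
        ≡⟨ Eq.trans (FC.+-identityˡ _) (coeff-tᵐ*-≥ p (drop p f) (n ∸ p)) ⟩
      coeff (drop p f) (n ∸ p)          ≡⟨ Eq.trans (coeff-drop p f (n ∸ p)) (cong (coeff f) n≡p+[n-p]) ⟩
      coeff f n                         ∎
      where
      open Eq.≡-Reasoning
      n≡p+[n-p] = ℕP.m+[n∸m]≡n p≤n
      const-above : ∀ n → p ≤ n → coeff (const (coeff f 0)) n ≡ 0#
      const-above zero    p≤0 = ⊥-elim (ℕP.<⇒≱ (ℕ.>-nonZero⁻¹ p) p≤0)
      const-above (suc n) _   = refl

  *ₚ-^ₚ : ∀ f g n → (f *ₚ g) ^ₚ n ≃ f ^ₚ n *ₚ g ^ₚ n
  *ₚ-^ₚ f g n = ≃-trans (≃-reflexive (Eq.sym (^ₛ≡^ₚ n (f *ₚ g))))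
    (≃-trans (PolyExp.^-distrib-* f g n) (≃-reflexive (cong₂ _*ₚ_ (^ₛ≡^ₚ n f) (^ₛ≡^ₚ n g))))

  InF[tᵖ]⇒pthPower : ∀ f → InF[tᵖ] f → Σ Poly (λ b → f ≃ b ^ₚ p)
  InF[tᵖ]⇒pthPower f = <-rec (λ l → ∀ f → length f ≡ l → InF[tᵖ] f → Σ Poly (λ b → f ≃ b ^ₚ p))
                             step (length f) f refl
    where
    []^ₚ : ∀ n → .{{NonZero n}} → [] ^ₚ n ≃ []
    []^ₚ (suc n) = ≃-refl
    step : ∀ l → (∀ {l′} → l′ < l → ∀ f → length f ≡ l′ → InF[tᵖ] f → Σ Poly (λ b → f ≃ b ^ₚ p)) →
           ∀ f → length f ≡ l → InF[tᵖ] f → Σ Poly (λ b → f ≃ b ^ₚ p)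
    step l recurse []      _        _  = [] , ≃-sym ([]^ₚ p)
    step l recurse (a ∷ f) refl f∈ = const r +ₚ tₚ *ₚ b , (begin
      a ∷ f                                        ≈⟨ InF[tᵖ]-split f∈ ⟩
      const a +ₚ tₚ ^ₚ p *ₚ drop p (a ∷ f)         ≈⟨ +ₚ-cong (∷-cong (Eq.sym rᵖ≡a) ≃-refl) (*ₚ-congʳ (tₚ ^ₚ p) drop≃bᵖ) ⟩
      const (r ^F p) +ₚ tₚ ^ₚ p *ₚ b ^ₚ p          ≈⟨ +ₚ-cong (≃-sym (const-^ₚ r p)) (≃-sym (*ₚ-^ₚ tₚ b p)) ⟩
      const r ^ₚ p +ₚ (tₚ *ₚ b) ^ₚ p               ≈⟨ ≃-sym (frobenius (const r) (tₚ *ₚ b)) ⟩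
      (const r +ₚ tₚ *ₚ b) ^ₚ p                    ∎)
      where
      open ≃-Reasoning
      r = proj₁ (pthRoot-F a)
      rᵖ≡a = proj₂ (pthRoot-F a)
      shorter : length (drop p (a ∷ f)) < length (a ∷ f)
      shorter = Eq.subst (_< suc (length f)) (Eq.sym (LP.length-drop p (a ∷ f)))
                  (Eq.subst (λ n → suc (length f) ∸ n < suc (length f)) (ℕP.suc-pred p) (s≤s (ℕP.m∸n≤m (length f) (ℕ.pred p))))
      IH = recurse shorter (drop p (a ∷ f)) refl (InF[tᵖ]-drop f∈)
      b = proj₁ IH
      drop≃bᵖ = proj₂ IH

  ∂≃[]⇒pthPower : ∀ f → ∂ f ≃ [] → Σ Poly (λ b → f ≃ b ^ₚ p)
  ∂≃[]⇒pthPower f ∂f≃[] = InF[tᵖ]⇒pthPower f (∂≃[]⇒InF[tᵖ] {f} ∂f≃[])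

  -- Wieferich primes

  HasDegree-^ₚ : ∀ {b i} n → HasDegree b i → HasDegree (b ^ₚ n) (n ℕ.* i)
  HasDegree-^ₚ zero    _            = 1# , LeadingTerm-const 1≢0
  HasDegree-^ₚ (suc n) (c , lb) with HasDegree-^ₚ n (c , lb)
  ... | (_ , lbⁿ) = _ , LeadingTerm-*ₚ lb lbⁿ

  -- ℘ = b · b^(p-1) with p - 1 ≥ 1 would force deg b = 0
  irreducible≄pthPower : ∀ {℘ d} → MonicIrreducible ℘ d → ∀ b → ¬ ℘ ≃ b ^ₚ p
  irreducible≄pthPower {℘} {d} mi@(monic , _ , _ , factors) b ℘≃bᵖ =
    impossible (factor-degrees {g = b} {h = b ^ₚ (p ∸ 1)} (monic⇒LeadingTerm {℘} monic) ℘≃b*bᵖ⁻¹)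
    where
    ℘≃b*bᵖ⁻¹ : ℘ ≃ b *ₚ b ^ₚ (p ∸ 1)
    ℘≃b*bᵖ⁻¹ = ≃-trans ℘≃bᵖ (≃-reflexive (cong (b ^ₚ_) (Eq.sym (ℕP.suc-pred p))))
    impossible : (Σ ℕ λ i → Σ ℕ λ j → HasDegree b i × HasDegree (b ^ₚ (p ∸ 1)) j × i ℕ.+ j ≡ d) → ⊥
    impossible (i , j , db , dbᵖ⁻¹ , i+j≡d) = [ b-nonunit , bᵖ⁻¹-nonunit ] (factors b (b ^ₚ (p ∸ 1)) (at ℘≃b*bᵖ⁻¹))
      where
      j≡[p-1]i : j ≡ (p ∸ 1) ℕ.* i
      j≡[p-1]i = degree-unique (proj₂ dbᵖ⁻¹) (proj₂ (HasDegree-^ₚ (p ∸ 1) db))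
      i≢0 : i ≢ 0
      i≢0 i≡0 = ℕP.<⇒≢ (irreducible⇒degree≥1 {℘} mi) (Eq.sym (begin
        d                         ≡⟨ Eq.sym i+j≡d ⟩
        i ℕ.+ j                   ≡⟨ cong₂ ℕ._+_ i≡0 j≡[p-1]i ⟩
        0 ℕ.+ (p ∸ 1) ℕ.* i       ≡⟨ cong ((p ∸ 1) ℕ.*_) i≡0 ⟩
        (p ∸ 1) ℕ.* 0             ≡⟨ ℕP.*-zeroʳ (p ∸ 1) ⟩
        0                         ∎))
        where open Eq.≡-Reasoning
      b-nonunit : ¬ IsUnit b
      b-nonunit unit = i≢0 (unit⇒degree0 unit db)
      bᵖ⁻¹-nonunit : ¬ IsUnit (b ^ₚ (p ∸ 1))
      bᵖ⁻¹-nonunit unit with ℕP.m*n≡0⇒m≡0∨n≡0 (p ∸ 1) (Eq.trans (Eq.sym j≡[p-1]i) (unit⇒degree0 unit dbᵖ⁻¹))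
      ... | inj₁ p-1≡0 = ℕP.<⇒≱ (ℕ.nonTrivial⇒n>1 p {{prime⇒nonTrivial p-prime}}) (ℕP.m∸n≡0⇒m≤n p-1≡0)
      ... | inj₂ i≡0   = i≢0 i≡0

  module Criterion (℘ : Poly) (d : ℕ) (irreducible : MonicIrreducible ℘ d) where
    open Fermat ℘ d irreducible using (N; fermat)

    ∂[a^N-a]≃-∂a : ∀ a → ∂ (a ^ₚ N -ₚ a) ≃ negₚ (∂ a)
    ∂[a^N-a]≃-∂a a = ≃-trans (∂-+ (a ^ₚ N) (negₚ a))
      (+ₚ-cong (∂-^-cast≡0 a N (cast-q^d d (irreducible⇒degree≥1 {℘} irreducible))) (∂-neg a))

    ℘∤∂℘ : ¬ ℘ ∣ ∂ ℘
    ℘∤∂℘ ℘∣∂℘ = irreducible≄pthPower irreducible (proj₁ ℘≃bᵖ) (proj₂ ℘≃bᵖ)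
      where
      ∂℘-degreeBelow : DegreeBelow (∂ ℘) d
      ∂℘-degreeBelow n d≤n = Eq.trans (coeff-∂ ℘ n)
        (Eq.trans (cong (cast (suc n) *_) (proj₂ (proj₁ irreducible) (suc n) (s≤s d≤n))) (FC.zeroʳ _))
      ℘≃bᵖ = ∂≃[]⇒pthPower ℘ (∣∧degree<⇒≃[] ℘∣∂℘ (monic⇒LeadingTerm {℘} (proj₁ irreducible)) ∂℘-degreeBelow)

    ℘²∣⇒℘∣∂ : ∀ a → ℘ *ₚ ℘ ∣ a ^ₚ N -ₚ a → ℘ ∣ ∂ a
    ℘²∣⇒℘∣∂ a (w , a^N-a≃w℘²) = ∣-respʳ (+ₚ-Properties.⁻¹-involutive (∂ a))
                                   (∣-negₚ (∣-respʳ (∂[a^N-a]≃-∂a a) ℘∣∂[a^N-a]))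
      where
      ℘∣∂[℘²] : ℘ ∣ ∂ (℘ *ₚ ℘)
      ℘∣∂[℘²] = ∣-respʳ (≃-sym (∂-*ₚ ℘ ℘)) (∣-+ₚ (∣*ˡ (∂ ℘)) (∣⇒∣*ʳ (∂ ℘) ∣-refl))
      ℘∣∂[a^N-a] : ℘ ∣ ∂ (a ^ₚ N -ₚ a)
      ℘∣∂[a^N-a] = ∣-respʳ (≃-sym (≃-trans (∂-cong a^N-a≃w℘²) (∂-*ₚ w (℘ *ₚ ℘))))
                     (∣-+ₚ (∣⇒∣*ˡ (∂ w) (∣*ˡ ℘)) (∣⇒∣*ˡ w ℘∣∂[℘²]))

    -- Fermat gives a^N - a = u℘; differentiating, ℘ ∣ u ∂℘, hence ℘ ∣ u
    ℘∣∂⇒℘²∣ : ∀ a → ℘ ∣ ∂ a → ℘ *ₚ ℘ ∣ a ^ₚ N -ₚ a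
    ℘∣∂⇒℘²∣ a ℘∣∂a with irreducible-prime irreducible u (∂ ℘) ℘∣u∂℘
      where
      u = proj₁ (fermat a)
      a^N-a≃u℘ = proj₂ (fermat a)
      ℘∣∂[a^N-a] : ℘ ∣ ∂ (a ^ₚ N -ₚ a)
      ℘∣∂[a^N-a] = ∣-respʳ (≃-sym (∂[a^N-a]≃-∂a a)) (∣-negₚ ℘∣∂a)
      ℘∣u∂℘ : ℘ ∣ u *ₚ ∂ ℘
      ℘∣u∂℘ = ∣-respʳ (+ₚ-Properties.xyx⁻¹≈y (∂ u *ₚ ℘) (u *ₚ ∂ ℘))
                (∣--ₚ (∣-respʳ (≃-trans (∂-cong a^N-a≃u℘) (∂-*ₚ u ℘)) ℘∣∂[a^N-a]) (∣*ˡ (∂ u)))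
    ... | inj₁ (k , u≃k℘) = k , ≃-trans (proj₂ (fermat a)) (≃-trans (*ₚ-congˡ ℘ u≃k℘) (*ₚ-assoc k ℘ ℘))
    ... | inj₂ ℘∣∂℘      = ⊥-elim (℘∤∂℘ ℘∣∂℘)

  wieferich⇒∣∂ : ∀ a ℘ → Wieferich a ℘ → Σ ℕ (λ d → MonicIrreducible ℘ d × ℘ ∣ ∂ a)
  wieferich⇒∣∂ a ℘ (d , irreducible , (w , ℘²∣)) = d , irreducible , Criterion.℘²∣⇒℘∣∂ ℘ d irreducible a (w , ⟨ ℘²∣ ⟩)

  ∣∂⇒wieferich : ∀ a ℘ d → MonicIrreducible ℘ d → ℘ ∣ ∂ a → Wieferich a ℘
  ∣∂⇒wieferich a ℘ d irreducible ℘∣∂a = d , irreducible , (proj₁ ℘²∣ , at (proj₂ ℘²∣))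
    where ℘²∣ = Criterion.℘∣∂⇒℘²∣ ℘ d irreducible a ℘∣∂a

  monicOfIndex : ∀ k → Fin (q ℕ.^ k) → Poly
  monicOfIndex k = fromIndex k 1ₚ

  monicOfIndex-monic : ∀ k i → MonicOfDegree (monicOfIndex k i) k
  monicOfIndex-monic k i = Eq.trans (cong (coeff (monicOfIndex k i)) (Eq.sym (ℕP.+-identityʳ k))) (coeff-fromIndex-above k 1ₚ i 0)
                         , λ n k<n → Eq.trans (coeff-fromIndex-≥ k 1ₚ i (ℕP.<⇒≤ k<n)) (above-0 (n ∸ k) (ℕP.m<n⇒0<n∸m k<n))
    where
    above-0 : ∀ m → 0 < m → coeff 1ₚ m ≡ 0#
    above-0 (suc m) _ = refl

  monic≃monicOfIndex : ∀ {g k} → MonicOfDegree g k → g ≃ monicOfIndex k (index k g)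
  monic≃monicOfIndex {g} {k} (leading , above) = ≃-sym (fromIndex-index k 1ₚ g g-above)
    where
    g-above : ∀ n → coeff g (k ℕ.+ n) ≡ coeff 1ₚ n
    g-above zero    = Eq.trans (cong (coeff g) (ℕP.+-identityʳ k)) leading
    g-above (suc n) = above (k ℕ.+ suc n) (ℕP.m<m+n k (s≤s z≤n))

  ProperMonicDivisor : Poly → ℕ → Set
  ProperMonicDivisor m e = Σ ℕ λ k → k < e × (1 ≤ k × Σ (Fin (q ℕ.^ k)) λ i → monicOfIndex k i ∣ m)

  properMonicDivisor? : ∀ m e → Dec (ProperMonicDivisor m e)
  properMonicDivisor? m = ℕP.anyUpTo? λ k → (1 ℕP.≤? k) ×-dec
    FinP.any? (λ i → Division.m∣? (monicOfIndex k i) (monicOfIndex-monic k i) m)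

  MonicIrreducibleFactor : Poly → Set
  MonicIrreducibleFactor m = Σ Poly λ ℘ → Σ ℕ λ d → MonicIrreducible ℘ d × ℘ ∣ m

  -- of all monic divisors of positive degree, one of least degree is irreducible
  monicIrreducibleFactor : ∀ {e} m → MonicOfDegree m e → 1 ≤ e → MonicIrreducibleFactor m
  monicIrreducibleFactor {e} = <-rec (λ e → ∀ m → MonicOfDegree m e → 1 ≤ e → MonicIrreducibleFactor m) step e
    where
    step : ∀ e → (∀ {e′} → e′ < e → ∀ m → MonicOfDegree m e′ → 1 ≤ e′ → MonicIrreducibleFactor m) →
           ∀ m → MonicOfDegree m e → 1 ≤ e → MonicIrreducibleFactor m
    step e recurse m monic 1≤e with properMonicDivisor? m e
    ... | yes (k , k<e , 1≤k , i , g∣m) with recurse k<e (monicOfIndex k i) (monicOfIndex-monic k i) 1≤k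
    ...   | ℘ , d , irreducible , ℘∣g = ℘ , d , irreducible , ∣-trans ℘∣g g∣m
    step e recurse m monic 1≤e | no noProper = m , e , (monic , irreducible) , ∣-refl
      where
      lm = monic⇒LeadingTerm {m} monic
      irreducible : Irreducible m
      irreducible = (λ m≈[] → LeadingTerm⇒≄[] lm ⟨ m≈[] ⟩)
                  , (λ unit → ℕP.<⇒≢ 1≤e (Eq.sym (unit⇒degree0 unit (1# , lm))))
                  , factors
        where
        factors : ∀ g h → m ≈ g *ₚ h → IsUnit g ⊎ IsUnit h
        factors g h m≈gh with factor-degrees {g = g} {h} lm ⟨ m≈gh ⟩
        ... | zero  , _     , dg , _  , _ = inj₁ (degree0⇒unit dg)
        ... | suc i , zero  , _  , dh , _ = inj₂ (degree0⇒unit dh)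
        ... | suc i , suc j , (c , lg) , _ , i+j≡e = ⊥-elim (noProper (suc i , i<e , s≤s z≤n , index (suc i) g′ , g′∣m))
          where
          i<e : suc i < e
          i<e = Eq.subst (suc i <_) i+j≡e (ℕP.m<m+n (suc i) (s≤s z≤n))
          c⁻¹ = proj₁ (inverse c (leading≢0 lg))
          cc⁻¹≡1 = proj₂ (inverse c (leading≢0 lg))
          g′ = scale c⁻¹ g
          g′-monic = scale-inverse-monic lg cc⁻¹≡1
          g′∣m : monicOfIndex (suc i) (index (suc i) g′) ∣ m
          g′∣m = h *ₚ const c , (begin
            m                              ≈⟨ ⟨ m≈gh ⟩ ⟩
            g *ₚ h                         ≈⟨ *ₚ-comm g h ⟩
            h *ₚ g                         ≈⟨ *ₚ-congʳ h (≃-trans (≃-sym (scale-inverse cc⁻¹≡1 g)) (scale≃const-*ₚ c g′)) ⟩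
            h *ₚ (const c *ₚ g′)           ≈⟨ ≃-sym (*ₚ-assoc h (const c) g′) ⟩
            (h *ₚ const c) *ₚ g′           ≈⟨ *ₚ-congʳ (h *ₚ const c) (monic≃monicOfIndex {g′} g′-monic) ⟩
            (h *ₚ const c) *ₚ monicOfIndex (suc i) (index (suc i) g′) ∎)
            where open ≃-Reasoning

  ∣⇒degree≤ : ∀ {f g j d c c′} → LeadingTerm f j c → LeadingTerm g d c′ → g ∣ f → d ≤ j
  ∣⇒degree≤ {d = d} lf lg (h , f≃hg) with ≃[]⊎degree h
  ... | inj₁ h≃[]          = ⊥-elim (LeadingTerm⇒≄[] lf (≃-trans f≃hg (*ₚ-zeroˡ _ h≃[])))
  ... | inj₂ (i , _ , lh) = Eq.subst (d ≤_) (degree-unique (LeadingTerm-*ₚ lh lg) (LeadingTerm-cong f≃hg lf)) (ℕP.m≤n+m d i)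

  ∂-ct : ∀ c → ∂ (scale c tₚ) ≃ const c
  ∂-ct c = ∷-cong (Eq.trans (cong (_* (c * 1#)) (FC.+-identityʳ 1#)) (Eq.trans (FC.*-identityˡ _) (FC.*-identityʳ c))) ≃-refl

  ∂-pthPower+ct : ∀ b c → ∂ (b ^ₚ p +ₚ scale c tₚ) ≃ const c
  ∂-pthPower+ct b c = ≃-trans (∂-+ (b ^ₚ p) (scale c tₚ)) (+ₚ-cong (∂-^p b) (∂-ct c))

  pthPower⇒allWieferich : ∀ a → Σ Poly (λ b → a ≈ b ^ₚ p) → ∀ ℘ d → MonicIrreducible ℘ d → Wieferich a ℘
  pthPower⇒allWieferich a (b , a≈bᵖ) ℘ d irreducible =
    ∣∂⇒wieferich a ℘ d irreducible (∣-respʳ (≃-sym (≃-trans (∂-cong {a} {b ^ₚ p} ⟨ a≈bᵖ ⟩) (∂-^p b))) ∣[])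

  pthPower+ct⇒noWieferich : ∀ a → Σ Poly (λ b → Σ F (λ c → c ≢ 0# × a ≈ b ^ₚ p +ₚ scale c tₚ)) → ∀ ℘ → ¬ Wieferich a ℘
  pthPower+ct⇒noWieferich a (b , c , c≢0 , a≈bᵖ+ct) ℘ w with wieferich⇒∣∂ a ℘ w
  ... | d , irreducible , ℘∣∂a =
    irreducible∤const irreducible c≢0 (∣-respʳ (≃-trans (∂-cong {a} {b ^ₚ p +ₚ scale c tₚ} ⟨ a≈bᵖ+ct ⟩) (∂-pthPower+ct b c)) ℘∣∂a)

  infinitelyManyWieferich⇒pthPower : ∀ a → InfinitelyManyWieferich a → Σ Poly (λ b → a ≈ b ^ₚ p)
  infinitelyManyWieferich⇒pthPower a infinitelyMany with ≃[]⊎degree (∂ a)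
  ... | inj₁ ∂a≃[] = proj₁ b , at (proj₂ b)
    where b = ∂≃[]⇒pthPower a ∂a≃[]
  ... | inj₂ (j , c , l∂a) = ⊥-elim (escapes (infinitelyMany candidates))
    where
    candidates : List Poly
    candidates = map (fromIndex (suc j) []) (allFin (q ℕ.^ suc j))
    -- every a-Wieferich prime divides ∂a, so has degree at most j
    escapes : Σ Poly (λ ℘ → Wieferich a ℘ × All (λ g → ¬ ℘ ≈ g) candidates) → ⊥
    escapes (℘ , w , avoids) = All.lookup avoids listed (at (≃-sym ℘≃candidate))
      where
      d = proj₁ (wieferich⇒∣∂ a ℘ w)
      irreducible = proj₁ (proj₂ (wieferich⇒∣∂ a ℘ w))
      l℘ = monic⇒LeadingTerm {℘} (proj₁ irreducible)
      d≤j = ∣⇒degree≤ l∂a l℘ (proj₂ (proj₂ (wieferich⇒∣∂ a ℘ w)))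
      ℘≃candidate : fromIndex (suc j) [] (index (suc j) ℘) ≃ ℘
      ℘≃candidate = fromIndex-index (suc j) [] ℘ (λ n → LeadingTerm⇒DegreeBelow l℘ (s≤s d≤j) (suc j ℕ.+ n) (ℕP.m≤m+n (suc j) n))
      listed : fromIndex (suc j) [] (index (suc j) ℘) ∈ candidates
      listed = ∈-map⁺ (fromIndex (suc j) []) (∈-allFin (index (suc j) ℘))

  noWieferich⇒pthPower+ct : ∀ a → (∀ ℘ → ¬ Wieferich a ℘) → Σ Poly (λ b → Σ F (λ c → c ≢ 0# × a ≈ b ^ₚ p +ₚ scale c tₚ))
  noWieferich⇒pthPower+ct a noneWieferich with ≃[]⊎degree (∂ a)
  ... | inj₁ ∂a≃[] = ⊥-elim (noneWieferich tₚ (∣∂⇒wieferich a tₚ 1 tₚ-irreducible (∣-respʳ (≃-sym ∂a≃[]) ∣[])))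
  ... | inj₂ (zero , c , l∂a) = b , c , leading≢0 l∂a , at (≃-trans (≃-sym (x-y+y≃x a ct)) (+ₚ-cong a-ct≃bᵖ ≃-refl))
    where
    ct = scale c tₚ
    ∂[a-ct]≃[] : ∂ (a -ₚ ct) ≃ []
    ∂[a-ct]≃[] = ≃-trans (∂-+ a (negₚ ct)) (≃-trans (+ₚ-cong (LeadingTerm-0⇒≃const l∂a) (≃-trans (∂-neg ct) (negₚ-cong (∂-ct c))))
                   (+ₚ-inverseʳ (const c)))
    b = proj₁ (∂≃[]⇒pthPower (a -ₚ ct) ∂[a-ct]≃[])
    a-ct≃bᵖ = proj₂ (∂≃[]⇒pthPower (a -ₚ ct) ∂[a-ct]≃[])
  ... | inj₂ (suc j , c , l∂a) = ⊥-elim (noneWieferich ℘ (∣∂⇒wieferich a ℘ (proj₁ (proj₂ factor)) irreducible (∣-trans ℘∣m m∣∂a)))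
    where
    c⁻¹ = proj₁ (inverse c (leading≢0 l∂a))
    cc⁻¹≡1 = proj₂ (inverse c (leading≢0 l∂a))
    m = scale c⁻¹ (∂ a)
    m∣∂a : m ∣ ∂ a
    m∣∂a = const c , ≃-trans (≃-sym (scale-inverse cc⁻¹≡1 (∂ a))) (scale≃const-*ₚ c m)
    factor = monicIrreducibleFactor m (scale-inverse-monic l∂a cc⁻¹≡1) (s≤s z≤n)
    ℘ = proj₁ factor
    irreducible = proj₁ (proj₂ (proj₂ factor))
    ℘∣m = proj₂ (proj₂ (proj₂ factor))

theorem2 : (K : FiniteField) → (a : PolyOver.Poly K) →
    let open FiniteField K
        open PolyOver K
    in ((InfinitelyManyWieferich a → Σ Poly (λ b → a ≈ b ^ₚ p))
       × ((Σ Poly (λ b → a ≈ b ^ₚ p)) → ∀ ℘ d → MonicIrreducible ℘ d → Wieferich a ℘))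
     × (((∀ ℘ → ¬ Wieferich a ℘) → Σ Poly (λ b → Σ F (λ c → c ≢ 0# × a ≈ (b ^ₚ p) +ₚ scale c tₚ)))
       × (Σ Poly (λ b → Σ F (λ c → c ≢ 0# × a ≈ (b ^ₚ p) +ₚ scale c tₚ)) → ∀ ℘ → ¬ Wieferich a ℘))
theorem2 K a =
    (infinitelyManyWieferich⇒pthPower a , pthPower⇒allWieferich a)
  , (noWieferich⇒pthPower+ct a , pthPower+ct⇒noWieferich a)
  where open PolynomialsOverFiniteField K
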